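{- Let $\Gamma$ be a connected graph. Then $C_3(L(\Gamma))\cong\Gamma$ if and only if all of the following hold: (1) every vertex of $\Gamma$ has degree $2$ or $3$; (2) every vertex of degree $2$ in $\Gamma$ is contained in a triangle; (3) every triangle of $\Gamma$ contains exactly one vertex of degree $2$; (4) distinct triangles of $\Gamma$ share no vertices.
   Context: All graphs are finite, without loops or parallel edges. A triangle is a clique of order $3$. The line graph $L(\Gamma)$ has the edges of $\Gamma$ as vertices, two edges being adjacent iff they share an endpoint. For a graph $H$, $C_3(H)$ is the graph whose vertices are the triangles of $H$, two distinct triangles being adjacent iff they share at least one vertex. -}

module Defs where

open import Data.Nat using (ℕ; _<ᵇ_; _≡ᵇ_; _+_)
open import Data.Bool using (Bool; true; false; T; _∧_; _∨_; not; if_then_else_)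
open import Data.Fin using (Fin; toℕ)
import Data.Fin as F
open import Data.List using (List; _∷_; []; map; allFin)
open import Data.Nat.ListAction using (sum)
open import Data.Product using (Σ; ∃; _×_; _,_)
open import Data.Sum using (_⊎_)
open import Data.Empty using (⊥)
open import Relation.Nullary using (yes; no; ¬_)
open import Relation.Nullary.Decidable using (⌊_⌋)
open import Relation.Binary.PropositionalEquality using (_≡_; refl; _≢_)
open import Relation.Binary.Definitions using (DecidableEquality)
open import Function.Bundles using (_↔_; Inverse)

record FinGraph (n : ℕ) : Set where
  field
    edge?   : Fin n → Fin n → Bool
    sym     : ∀ x y → edge? x y ≡ edge? y x
    irrefl  : ∀ x → edge? x x ≡ false
open FinGraph public

record Graph : Set₁ where
  field
    V   : Set
    adj : V → V → Bool

-- A graph whose vertex type has decidable equality and an auxiliary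
-- strict total order _<ᵒ_ (used only to list each triangle exactly once).
record OGraph : Set₁ where
  field
    V    : Set
    adj  : V → V → Bool
    _≟ᵒ_ : DecidableEquality V
    _<ᵒ_ : V → V → Bool

toGraph : OGraph → Graph
toGraph G = record { V = OGraph.V G ; adj = OGraph.adj G }

_≅_ : Graph → Graph → Set
G ≅ H = Σ (Graph.V G ↔ Graph.V H) λ f →
          ∀ x y → Graph.adj G x y ≡ Graph.adj H (Inverse.to f x) (Inverse.to f y)

finO : ∀ {n} → FinGraph n → OGraph
finO {n} Γ = record
  { V = Fin n ; adj = edge? Γ ; _≟ᵒ_ = F._≟_ ; _<ᵒ_ = λ x y → toℕ x <ᵇ toℕ y }

finG : ∀ {n} → FinGraph n → Graph
finG Γ = toGraph (finO Γ)

record Triangle (G : OGraph) : Set where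
  constructor tri
  open OGraph G
  field
    a b c : V
    .isTri : T ((a <ᵒ b) ∧ (b <ᵒ c) ∧ adj a b ∧ adj b c ∧ adj a c)

module _ {G : OGraph} where
  open OGraph G

  _∈ᵗ_ : V → Triangle G → Set
  v ∈ᵗ tri a b c _ = v ≡ a ⊎ v ≡ b ⊎ v ≡ c

  private
    eqb : V → V → Bool
    eqb x y = ⌊ x ≟ᵒ y ⌋

  _≟ᵗ_ : DecidableEquality (Triangle G)
  tri a b c _ ≟ᵗ tri a' b' c' _ with a ≟ᵒ a' | b ≟ᵒ b' | c ≟ᵒ c'
  ... | yes refl | yes refl | yes refl = yes refl
  ... | no ne | _ | _ = no λ { refl → ne refl }
  ... | yes _ | no ne | _ = no λ { refl → ne refl }
  ... | yes _ | yes _ | no ne = no λ { refl → ne refl }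

  shareᵇ : Triangle G → Triangle G → Bool
  shareᵇ (tri a b c _) (tri a' b' c' _) =
    eqb a a' ∨ eqb a b' ∨ eqb a c' ∨
    eqb b a' ∨ eqb b b' ∨ eqb b c' ∨
    eqb c a' ∨ eqb c b' ∨ eqb c c'

C₃ : OGraph → Graph
C₃ G = record
  { V = Triangle G
  ; adj = λ s t → not ⌊ s ≟ᵗ t ⌋ ∧ shareᵇ s t }

record Edge {n : ℕ} (Γ : FinGraph n) : Set where
  constructor edge
  field
    u v : Fin n
    .isEdge : T ((toℕ u <ᵇ toℕ v) ∧ edge? Γ u v)

module _ {n : ℕ} {Γ : FinGraph n} where

  _≟ᵉ_ : DecidableEquality (Edge Γ)
  edge u v _ ≟ᵉ edge u' v' _ with u F.≟ u' | v F.≟ v'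
  ... | yes refl | yes refl = yes refl
  ... | no ne | _ = no λ { refl → ne refl }
  ... | yes _ | no ne = no λ { refl → ne refl }

  private
    eqf : Fin n → Fin n → Bool
    eqf x y = ⌊ x F.≟ y ⌋

  adjᴸ : Edge Γ → Edge Γ → Bool
  adjᴸ e@(edge u v _) f@(edge u' v' _) =
    not ⌊ e ≟ᵉ f ⌋ ∧ (eqf u u' ∨ eqf u v' ∨ eqf v u' ∨ eqf v v')

  _<ᴸ_ : Edge Γ → Edge Γ → Bool
  edge u v _ <ᴸ edge u' v' _ =
    (toℕ u <ᵇ toℕ u') ∨ (eqf u u' ∧ (toℕ v <ᵇ toℕ v'))

L : ∀ {n} → FinGraph n → OGraph
L Γ = record { V = Edge Γ ; adj = adjᴸ ; _≟ᵒ_ = _≟ᵉ_ ; _<ᵒ_ = _<ᴸ_ }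

deg : ∀ {n} → FinGraph n → Fin n → ℕ
deg {n} Γ v = sum (map (λ w → if edge? Γ v w then 1 else 0) (allFin n))

data Walk {n : ℕ} (Γ : FinGraph n) : Fin n → Fin n → Set where
  here : ∀ {v} → Walk Γ v v
  step : ∀ {u w v} → T (edge? Γ u w) → Walk Γ w v → Walk Γ u v

Connected : ∀ {n} → FinGraph n → Set
Connected Γ = ∀ u v → Walk Γ u v

Cond1 Cond2 Cond3 Cond4 : ∀ {n} → FinGraph n → Set
Cond1 Γ = ∀ v → deg Γ v ≡ 2 ⊎ deg Γ v ≡ 3
Cond2 Γ = ∀ v → deg Γ v ≡ 2 → ∃ λ (t : Triangle (finO Γ)) → v ∈ᵗ t
Cond3 Γ = ∀ (t : Triangle (finO Γ)) →
  let d2 = λ x → if deg Γ x ≡ᵇ 2 then 1 else 0 in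
  d2 (Triangle.a t) + d2 (Triangle.b t) + d2 (Triangle.c t) ≡ 1
Cond4 Γ = ∀ (t t' : Triangle (finO Γ)) → t ≢ t' →
  ∀ v → v ∈ᵗ t → v ∈ᵗ t' → ⊥

-- Triangles of L(Γ) are stars (three edges at a common vertex) or the three sides of a triangle of Γ.
--
-- Under (1)–(4) a vertex of degree 3 carries exactly one star and a vertex of degree 2 lies on exactly
-- one triangle, which contains no other vertex of degree 2; sending each vertex to its star or to the
-- sides of its triangle is an isomorphism Γ ≅ C₃(L(Γ)).
--
-- Conversely, let C₃(L(Γ)) ≅ Γ. A vertex of maximum degree Δ ≥ 5 gives a star with more than Δ
-- neighbours in C₃(L(Γ)); for Δ = 4 the four stars at a vertex of degree 4 span a K₄ of Γ whose
-- vertices have degree 3, so the connected Γ would be that K₄. Hence Δ ≤ 3, and the vertices of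
-- C₃(L(Γ)) are the stars at the vertices of degree 3 and the triangles of Γ: there are as many "low"
-- vertices (degree ≤ 2) as triangles. Comparing the degree sums of Γ and C₃(L(Γ)) then gives
--   Σ_{u low} (#neighbours of degree 3 + deg u + 2·#triangles at u) = 6·#low + #pairs of triangles sharing a side,
-- while each summand is at most 6. So no two triangles share a side and every low vertex has degree 2,
-- lies on exactly one triangle and only has neighbours of degree 3; (1)–(4) follow.

module Submission where

open import Defs hiding (sym; irrefl)
open import Data.Bool using (Bool; true; false; T; _∧_; _∨_; not; if_then_else_)
open import Data.Bool.Properties using (T?; T-∧; T-∨; ∨-assoc)
open import Data.Empty using (⊥; ⊥-elim)
open import Data.Fin using (Fin; toℕ; zero; suc)
import Data.Fin as F
open import Data.Fin.Properties using (toℕ-injective)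
open import Data.List using (List; []; _∷_; _++_; length; map; filter; allFin; tabulate)
open import Data.List.Properties using (map-tabulate; length-map; length-++)
open import Data.List.Membership.Propositional using (_∈_; _∉_; find)
open import Data.List.Membership.Propositional.Properties using (∈-∃++; ∈-filter⁺; ∈-filter⁻; ∈-allFin; ∈-++⁻)
import Data.List.Membership.DecPropositional as DecMembership
open import Data.List.Relation.Unary.All using (All; []; _∷_; all?)
import Data.List.Relation.Unary.All as All
import Data.List.Relation.Unary.All.Properties as AllProperties
open import Data.List.Relation.Unary.AllPairs using (AllPairs; []; _∷_)
import Data.List.Relation.Unary.AllPairs as AllPairs
open import Data.List.Relation.Unary.Any using (here; there)
open import Data.List.Relation.Unary.Unique.Propositional using (Unique)
import Data.List.Relation.Unary.Unique.Propositional.Properties as Unique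
open import Data.Nat using (ℕ; zero; suc; _+_; _*_; _≤_; _<_; z≤n; s≤s; _<ᵇ_; _≡ᵇ_; _≤?_)
import Data.Nat.ListAction as List
open import Data.Nat.Properties
open import Data.Nat.Tactic.RingSolver using (solve-∀)
open import Data.Product using (Σ; ∃; ∃₂; _×_; _,_; proj₁; proj₂)
import Data.Product.Properties as Product
open import Data.Sum using (_⊎_; inj₁; inj₂)
import Data.Sum as Sum
open import Data.Unit using (tt)
open import Function using (_∘_)
open import Function.Bundles using (_⇔_; Equivalence; mk⇔; mk↔ₛ′; Inverse)
open import Function.Properties.Equivalence using () renaming (trans to ⇔-trans; sym to ⇔-sym)
open import Relation.Binary.Definitions using (DecidableEquality; tri<; tri≈; tri>)
open import Relation.Binary.PropositionalEquality
open import Relation.Nullary using (yes; no; ¬_; Dec)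
open import Relation.Nullary.Decidable using (⌊_⌋; toWitness; fromWitness; toWitnessFalse; fromWitnessFalse; recompute; _⊎-dec_)
open import Algebra.Properties.CommutativeSemigroup *-commutativeSemigroup using (x∙yz≈y∙xz)
open import Algebra.Properties.Semiring.Sum +-*-semiring
  using (sum; sum-syntax; sum-cong-≗; ∑-distrib-+; ∑-comm; *-distribˡ-sum; *-distribʳ-sum)

T-injective : ∀ {a b} → (T a → T b) → (T b → T a) → a ≡ b
T-injective {false} {false} _ _ = refl
T-injective {false} {true}  _ g = ⊥-elim (g tt)
T-injective {true}  {false} f _ = ⊥-elim (f tt)
T-injective {true}  {true}  _ _ = refl

T-∨₃ : ∀ p q r → T (p ∨ q ∨ r) ⇔ (T p ⊎ T q ⊎ T r)
T-∨₃ p q r = mk⇔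
  (λ h → Sum.map₂ (Equivalence.to (T-∨ {q} {r})) (Equivalence.to (T-∨ {p}) h))
  (λ h → Equivalence.from (T-∨ {p}) (Sum.map₂ (Equivalence.from (T-∨ {q} {r})) h))

∨-assoc₃ : ∀ p q r s → (p ∨ q ∨ r) ∨ s ≡ p ∨ q ∨ r ∨ s
∨-assoc₃ p q r s = trans (∨-assoc p (q ∨ r) s) (cong (p ∨_) (∨-assoc q r s))

module _ {A : Set} where

  infix 4 _∈₂_ _∈₃_ _⊆₂_ _≐₂_ _⊆₃_ _≐₃_

  _∈₂_ : A → A × A → Set
  v ∈₂ (x , y) = v ≡ x ⊎ v ≡ y

  _∈₃_ : A → A × A × A → Set
  v ∈₃ (x , y , z) = v ≡ x ⊎ v ≡ y ⊎ v ≡ z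

  _⊆₂_ : A × A → A × A → Set
  (x , y) ⊆₂ Q = x ∈₂ Q × y ∈₂ Q

  _≐₂_ : A × A → A × A → Set
  P ≐₂ Q = P ⊆₂ Q × Q ⊆₂ P

  _⊆₃_ : A × A × A → A × A × A → Set
  (x , y , z) ⊆₃ Q = x ∈₃ Q × y ∈₃ Q × z ∈₃ Q

  _≐₃_ : A × A × A → A × A × A → Set
  P ≐₃ Q = P ⊆₃ Q × Q ⊆₃ P

pattern 1st = inj₁ refl
pattern 2nd = inj₂ (inj₁ refl)
pattern 3rd = inj₂ (inj₂ refl)
pattern end₁ = inj₁ refl
pattern end₂ = inj₂ refl

module _ {A : Set} where

  ⊆₂-∈ : ∀ {P Q : A × A} → P ⊆₂ Q → ∀ {v} → v ∈₂ P → v ∈₂ Q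
  ⊆₂-∈ (x∈ , _) (inj₁ refl) = x∈
  ⊆₂-∈ (_ , y∈) (inj₂ refl) = y∈

  ≐₃-refl : ∀ {P : A × A × A} → P ≐₃ P
  ≐₃-refl = (1st , 2nd , 3rd) , (1st , 2nd , 3rd)

  ∉₃ : ∀ {v x y z : A} → v ≢ x → v ≢ y → v ≢ z → ¬ v ∈₃ (x , y , z)
  ∉₃ v≢x _ _ (inj₁ v≡x) = v≢x v≡x
  ∉₃ _ v≢y _ (inj₂ (inj₁ v≡y)) = v≢y v≡y
  ∉₃ _ _ v≢z (inj₂ (inj₂ v≡z)) = v≢z v≡z

  ⊆₂-trans : ∀ {P Q R : A × A} → P ⊆₂ Q → Q ⊆₂ R → P ⊆₂ R
  ⊆₂-trans (x∈ , y∈) Q⊆R = ⊆₂-∈ Q⊆R x∈ , ⊆₂-∈ Q⊆R y∈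

  ⊆₃-∈ : ∀ {P Q : A × A × A} → P ⊆₃ Q → ∀ {v} → v ∈₃ P → v ∈₃ Q
  ⊆₃-∈ (x∈ , _ , _) (inj₁ refl) = x∈
  ⊆₃-∈ (_ , y∈ , _) (inj₂ (inj₁ refl)) = y∈
  ⊆₃-∈ (_ , _ , z∈) (inj₂ (inj₂ refl)) = z∈

module _ {A : Set} (_≟_ : DecidableEquality A) where

  ∈₂ᵇ : A → A × A → Bool
  ∈₂ᵇ v (x , y) = ⌊ v ≟ x ⌋ ∨ ⌊ v ≟ y ⌋

  ∈₃ᵇ : A → A × A × A → Bool
  ∈₃ᵇ v (x , y , z) = ⌊ v ≟ x ⌋ ∨ ⌊ v ≟ y ⌋ ∨ ⌊ v ≟ z ⌋

  T-∈₂ᵇ : ∀ {v} P → T (∈₂ᵇ v P) ⇔ v ∈₂ P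
  T-∈₂ᵇ {v} (x , y) = mk⇔ (Sum.map toWitness toWitness ∘ Equivalence.to (T-∨ {⌊ v ≟ x ⌋}))
                          (Equivalence.from (T-∨ {⌊ v ≟ x ⌋}) ∘ Sum.map fromWitness fromWitness)

  T-∈₃ᵇ : ∀ {v} P → T (∈₃ᵇ v P) ⇔ v ∈₃ P
  T-∈₃ᵇ {v} (x , y , z) =
    mk⇔ (Sum.map toWitness (Sum.map toWitness toWitness) ∘ Equivalence.to ∨₃)
        (Equivalence.from ∨₃ ∘ Sum.map fromWitness (Sum.map fromWitness fromWitness))
    where ∨₃ = T-∨₃ ⌊ v ≟ x ⌋ ⌊ v ≟ y ⌋ ⌊ v ≟ z ⌋

-- Triangles of an ordered graph

record OGraphLaws (G : OGraph) : Set where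
  open OGraph G
  field
    <ᵒ-irrefl : ∀ {x} → ¬ T (x <ᵒ x)
    <ᵒ-trans  : ∀ {x y z} → T (x <ᵒ y) → T (y <ᵒ z) → T (x <ᵒ z)
    <ᵒ-total  : ∀ {x y} → x ≢ y → T (x <ᵒ y) ⊎ T (y <ᵒ x)
    adj-irrefl : ∀ {x} → ¬ T (adj x x)
    adj-sym   : ∀ {x y} → T (adj x y) → T (adj y x)

module TriangleProperties (G : OGraph) (laws : OGraphLaws G) where
  open OGraph G
  open OGraphLaws laws

  Adj : V → V → Set
  Adj x y = T (adj x y)

  adj⇒≢ : ∀ {x y} → Adj x y → x ≢ y
  adj⇒≢ xy refl = adj-irrefl xy

  <ᵒ⇒≢ : ∀ {x y} → T (x <ᵒ y) → x ≢ y
  <ᵒ⇒≢ x<y refl = <ᵒ-irrefl x<y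

  vertices : Triangle G → V × V × V
  vertices t = Triangle.a t , Triangle.b t , Triangle.c t

  private
    T-∧₅ : ∀ p q r s u → T (p ∧ q ∧ r ∧ s ∧ u) → T p × T q × T r × T s × T u
    T-∧₅ true true true true true _ = tt , tt , tt , tt , tt

    triangle-facts : (t : Triangle G) → let open Triangle t in
                     T (a <ᵒ b) × T (b <ᵒ c) × Adj a b × Adj b c × Adj a c
    triangle-facts (tri a b c p) = T-∧₅ _ _ _ _ _ (recompute (T? _) p)

  module _ (t : Triangle G) where
    open Triangle t

    a<b : T (a <ᵒ b)
    a<b = proj₁ (triangle-facts t)

    b<c : T (b <ᵒ c)
    b<c = proj₁ (proj₂ (triangle-facts t))

    a<c : T (a <ᵒ c)
    a<c = <ᵒ-trans a<b b<c

    adj-ab : Adj a b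
    adj-ab = proj₁ (proj₂ (proj₂ (triangle-facts t)))

    adj-bc : Adj b c
    adj-bc = proj₁ (proj₂ (proj₂ (proj₂ (triangle-facts t))))

    adj-ac : Adj a c
    adj-ac = proj₂ (proj₂ (proj₂ (proj₂ (triangle-facts t))))

  ∈ᵗ-adj : ∀ t {x y} → x ∈ᵗ t → y ∈ᵗ t → x ≢ y → Adj x y
  ∈ᵗ-adj t 1st 1st x≢y = ⊥-elim (x≢y refl)
  ∈ᵗ-adj t 1st 2nd _ = adj-ab t
  ∈ᵗ-adj t 1st 3rd _ = adj-ac t
  ∈ᵗ-adj t 2nd 1st _ = adj-sym (adj-ab t)
  ∈ᵗ-adj t 2nd 2nd x≢y = ⊥-elim (x≢y refl)
  ∈ᵗ-adj t 2nd 3rd _ = adj-bc t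
  ∈ᵗ-adj t 3rd 1st _ = adj-sym (adj-ac t)
  ∈ᵗ-adj t 3rd 2nd _ = adj-sym (adj-bc t)
  ∈ᵗ-adj t 3rd 3rd x≢y = ⊥-elim (x≢y refl)

  another-vertex : ∀ t {x} → x ∈ᵗ t → ∃ λ y → y ∈ᵗ t × x ≢ y
  another-vertex t 1st = Triangle.b t , 2nd , <ᵒ⇒≢ (a<b t)
  another-vertex t 2nd = Triangle.a t , 1st , <ᵒ⇒≢ (a<b t) ∘ sym
  another-vertex t 3rd = Triangle.a t , 1st , <ᵒ⇒≢ (a<c t) ∘ sym

  other-two : ∀ t {v} → v ∈ᵗ t → ∃₂ λ x y → vertices t ≐₃ (v , x , y) × v ≢ x × v ≢ y × x ≢ y
  other-two t 1st = _ , _ , ≐₃-refl , <ᵒ⇒≢ (a<b t) , <ᵒ⇒≢ (a<c t) , <ᵒ⇒≢ (b<c t)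
  other-two t 2nd = _ , _ , ((2nd , 1st , 3rd) , (2nd , 1st , 3rd)) , <ᵒ⇒≢ (a<b t) ∘ sym , <ᵒ⇒≢ (b<c t) , <ᵒ⇒≢ (a<c t)
  other-two t 3rd = _ , _ , ((2nd , 3rd , 1st) , (3rd , 1st , 2nd)) , <ᵒ⇒≢ (a<c t) ∘ sym , <ᵒ⇒≢ (b<c t) ∘ sym , <ᵒ⇒≢ (a<b t)

  private
    <ᵒ-asym : ∀ {x y} → T (x <ᵒ y) → ¬ T (y <ᵒ x)
    <ᵒ-asym x<y y<x = <ᵒ-irrefl (<ᵒ-trans x<y y<x)

    min-∈ᵗ : ∀ t {v} → v ∈ᵗ t → v ≡ Triangle.a t ⊎ T (Triangle.a t <ᵒ v)
    min-∈ᵗ t 1st = inj₁ refl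
    min-∈ᵗ t 2nd = inj₂ (a<b t)
    min-∈ᵗ t 3rd = inj₂ (a<c t)

    max-∈ᵗ : ∀ t {v} → v ∈ᵗ t → v ≡ Triangle.c t ⊎ T (v <ᵒ Triangle.c t)
    max-∈ᵗ t 1st = inj₂ (a<c t)
    max-∈ᵗ t 2nd = inj₂ (b<c t)
    max-∈ᵗ t 3rd = inj₁ refl

    same-min : ∀ s t → Triangle.a s ∈ᵗ t → Triangle.a t ∈ᵗ s → Triangle.a s ≡ Triangle.a t
    same-min s t as∈t at∈s with min-∈ᵗ t as∈t | min-∈ᵗ s at∈s
    ... | inj₁ e | _ = e
    ... | inj₂ _ | inj₁ e = sym e
    ... | inj₂ p | inj₂ q = ⊥-elim (<ᵒ-asym p q)

    same-max : ∀ s t → Triangle.c s ∈ᵗ t → Triangle.c t ∈ᵗ s → Triangle.c s ≡ Triangle.c t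
    same-max s t cs∈t ct∈s with max-∈ᵗ t cs∈t | max-∈ᵗ s ct∈s
    ... | inj₁ e | _ = e
    ... | inj₂ _ | inj₁ e = sym e
    ... | inj₂ p | inj₂ q = ⊥-elim (<ᵒ-asym q p)

  -- Triangles are listed in increasing order, so the vertex set determines the triangle.
  triangle-≐ : ∀ s t → vertices s ≐₃ vertices t → s ≡ t
  triangle-≐ s@(tri a b c _) t@(tri _ _ _ _) ((a∈ , b∈ , c∈) , (a′∈ , _ , c′∈)) =
    middle (same-min s t a∈ a′∈) (same-max s t c∈ c′∈) b∈
    where
    middle : a ≡ Triangle.a t → c ≡ Triangle.c t → b ∈ᵗ t → s ≡ t
    middle refl refl 1st = ⊥-elim (<ᵒ-irrefl (a<b s))
    middle refl refl 2nd = refl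
    middle refl refl 3rd = ⊥-elim (<ᵒ-irrefl (b<c s))

  ∈ᵗ⇔ : ∀ t {P} → vertices t ≐₃ P → ∀ {v} → v ∈ᵗ t ⇔ v ∈₃ P
  ∈ᵗ⇔ t (t⊆P , P⊆t) = mk⇔ (⊆₃-∈ t⊆P) (⊆₃-∈ P⊆t)

  vertices-injective : ∀ s t → vertices s ≡ vertices t → s ≡ t
  vertices-injective s t eq = triangle-≐ s t (subst (vertices s ≐₃_) eq ≐₃-refl)

  triangle-ext : ∀ s t → (∀ {v} → v ∈ᵗ s → v ∈ᵗ t) → (∀ {v} → v ∈ᵗ t → v ∈ᵗ s) → s ≡ t
  triangle-ext s t s⊆t t⊆s = triangle-≐ s t ((s⊆t 1st , s⊆t 2nd , s⊆t 3rd) , (t⊆s 1st , t⊆s 2nd , t⊆s 3rd))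

  triangle-⇔ : ∀ s t {P : V → Set} → (∀ v → v ∈ᵗ s ⇔ P v) → (∀ v → v ∈ᵗ t ⇔ P v) → s ≡ t
  triangle-⇔ s t s⇔ t⇔ = triangle-ext s t (λ {v} → Equivalence.from (t⇔ v) ∘ Equivalence.to (s⇔ v))
                                          (λ {v} → Equivalence.from (s⇔ v) ∘ Equivalence.to (t⇔ v))

  private
    T-∧₅⁻ : ∀ p q r s u → T p → T q → T r → T s → T u → T (p ∧ q ∧ r ∧ s ∧ u)
    T-∧₅⁻ true true true true true _ _ _ _ _ = tt

    sorted : ∀ {x y z} → T (x <ᵒ y) → T (y <ᵒ z) → Adj x y → Adj y z → Adj x z → Triangle G
    sorted {x} {y} {z} x<y y<z xy yz xz =
      tri x y z (T-∧₅⁻ (x <ᵒ y) (y <ᵒ z) (adj x y) (adj y z) (adj x z) x<y y<z xy yz xz)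

  triangle : ∀ {x y z} → Adj x y → Adj y z → Adj x z →
             Σ (Triangle G) λ t → vertices t ≐₃ (x , y , z)
  triangle xy yz xz
    with <ᵒ-total (adj⇒≢ xy) | <ᵒ-total (adj⇒≢ yz) | <ᵒ-total (adj⇒≢ xz)
  ... | inj₁ x<y | inj₁ y<z | _ =
    sorted x<y y<z xy yz xz , (1st , 2nd , 3rd) , (1st , 2nd , 3rd)
  ... | inj₁ x<y | inj₂ z<y | inj₁ x<z =
    sorted x<z z<y xz (adj-sym yz) xy , (1st , 3rd , 2nd) , (1st , 3rd , 2nd)
  ... | inj₁ x<y | inj₂ z<y | inj₂ z<x =
    sorted z<x x<y (adj-sym xz) xy (adj-sym yz) , (3rd , 1st , 2nd) , (2nd , 3rd , 1st)
  ... | inj₂ y<x | inj₁ y<z | inj₁ x<z =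
    sorted y<x x<z (adj-sym xy) xz yz , (2nd , 1st , 3rd) , (2nd , 1st , 3rd)
  ... | inj₂ y<x | inj₁ y<z | inj₂ z<x =
    sorted y<z z<x yz (adj-sym xz) (adj-sym xy) , (2nd , 3rd , 1st) , (3rd , 1st , 2nd)
  ... | inj₂ y<x | inj₂ z<y | _ =
    sorted z<y y<x (adj-sym yz) (adj-sym xy) (adj-sym xz) , (3rd , 2nd , 1st) , (3rd , 2nd , 1st)

  C₃Adj : Triangle G → Triangle G → Set
  C₃Adj s t = T (Graph.adj (C₃ G) s t)

  private
    shareᵇ⇔ : ∀ s t → T (shareᵇ s t) ⇔ (∃ λ v → v ∈ᵗ s × v ∈ᵗ t)
    shareᵇ⇔ s@(tri a b c _) t =
      mk⇔ (to ∘ Equivalence.to ∨₃ ∘ subst T regroup) (subst T (sym regroup) ∘ Equivalence.from ∨₃ ∘ from)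
      where
      _∈t : V → Bool
      v ∈t = ∈₃ᵇ _≟ᵒ_ v (vertices t)
      ∨₃ = T-∨₃ (a ∈t) (b ∈t) (c ∈t)
      regroup : shareᵇ s t ≡ a ∈t ∨ b ∈t ∨ c ∈t
      regroup = sym (trans (∨-assoc₃ ⌊ a ≟ᵒ _ ⌋ ⌊ a ≟ᵒ _ ⌋ ⌊ a ≟ᵒ _ ⌋ _)
        (cong (λ r → ⌊ a ≟ᵒ _ ⌋ ∨ ⌊ a ≟ᵒ _ ⌋ ∨ ⌊ a ≟ᵒ _ ⌋ ∨ r) (∨-assoc₃ ⌊ b ≟ᵒ _ ⌋ ⌊ b ≟ᵒ _ ⌋ ⌊ b ≟ᵒ _ ⌋ _)))
      ∈t⇔ : ∀ {v} → T (v ∈t) ⇔ v ∈ᵗ t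
      ∈t⇔ = T-∈₃ᵇ _≟ᵒ_ (vertices t)
      to : T (a ∈t) ⊎ T (b ∈t) ⊎ T (c ∈t) → ∃ λ v → v ∈ᵗ s × v ∈ᵗ t
      to (inj₁ p) = a , 1st , Equivalence.to ∈t⇔ p
      to (inj₂ (inj₁ p)) = b , 2nd , Equivalence.to ∈t⇔ p
      to (inj₂ (inj₂ p)) = c , 3rd , Equivalence.to ∈t⇔ p
      from : (∃ λ v → v ∈ᵗ s × v ∈ᵗ t) → T (a ∈t) ⊎ T (b ∈t) ⊎ T (c ∈t)
      from (_ , 1st , v∈t) = inj₁ (Equivalence.from ∈t⇔ v∈t)
      from (_ , 2nd , v∈t) = inj₂ (inj₁ (Equivalence.from ∈t⇔ v∈t))
      from (_ , 3rd , v∈t) = inj₂ (inj₂ (Equivalence.from ∈t⇔ v∈t))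

  C₃Adj⇔ : ∀ s t → C₃Adj s t ⇔ (s ≢ t × ∃ λ v → v ∈ᵗ s × v ∈ᵗ t)
  C₃Adj⇔ s t with s ≟ᵗ t
  ... | yes s≡t = mk⇔ (λ ()) (λ (s≢t , _) → s≢t s≡t)
  ... | no s≢t = mk⇔ (λ h → s≢t , Equivalence.to (shareᵇ⇔ s t) h) (Equivalence.from (shareᵇ⇔ s t) ∘ proj₂)

  C₃Adj-sym : ∀ s t → C₃Adj s t → C₃Adj t s
  C₃Adj-sym s t st = let (s≢t , v , v∈s , v∈t) = Equivalence.to (C₃Adj⇔ s t) st in
    Equivalence.from (C₃Adj⇔ t s) (s≢t ∘ sym , v , v∈t , v∈s)

-- Edges and the line graph

module Edges {n : ℕ} (Γ : FinGraph n) where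

  E : Set
  E = Edge Γ

  Adj : Fin n → Fin n → Set
  Adj x y = T (edge? Γ x y)

  adj-sym : ∀ {x y} → Adj x y → Adj y x
  adj-sym {x} {y} = subst T (FinGraph.sym Γ x y)

  adj⇒≢ : ∀ {x y} → Adj x y → x ≢ y
  adj⇒≢ {x} xy refl = subst T (FinGraph.irrefl Γ x) xy

  ends : E → Fin n × Fin n
  ends e = Edge.u e , Edge.v e

  infix 4 _∈ₑ_
  _∈ₑ_ : Fin n → E → Set
  z ∈ₑ e = z ∈₂ ends e

  _∈ₑ?_ : ∀ z e → Dec (z ∈ₑ e)
  z ∈ₑ? e = z F.≟ Edge.u e ⊎-dec z F.≟ Edge.v e

  private
    edge-facts : (e : E) → toℕ (Edge.u e) < toℕ (Edge.v e) × Adj (Edge.u e) (Edge.v e)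
    edge-facts (edge u v p) with recompute (T? _) p
    ... | q = <ᵇ⇒< _ _ (proj₁ (Equivalence.to T-∧ q)) , proj₂ (Equivalence.to (T-∧ {toℕ u <ᵇ toℕ v}) q)

  ends-< : (e : E) → toℕ (Edge.u e) < toℕ (Edge.v e)
  ends-< e = proj₁ (edge-facts e)

  ends-adj : (e : E) → Adj (Edge.u e) (Edge.v e)
  ends-adj e = proj₂ (edge-facts e)

  ends-≢ : (e : E) → Edge.u e ≢ Edge.v e
  ends-≢ e refl = <-irrefl refl (ends-< e)

  edge-≐ : ∀ e f → ends e ≐₂ ends f → e ≡ f
  edge-≐ e@(edge _ _ _) f@(edge _ _ _) ((u∈ , v∈) , (u′∈ , _)) with u∈ | v∈ | u′∈
  ... | inj₁ u≡u′ | inj₁ v≡u′ | _ = ⊥-elim (ends-≢ e (trans u≡u′ (sym v≡u′)))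
  ... | inj₁ refl | inj₂ refl | _ = refl
  ... | inj₂ u≡v′ | _ | inj₁ u′≡u = ⊥-elim (ends-≢ f (trans u′≡u u≡v′))
  ... | inj₂ u≡v′ | _ | inj₂ u′≡v = ⊥-elim (<-asym (subst₂ _<_ (cong toℕ u≡v′) (cong toℕ (sym u′≡v)) (ends-< e)) (ends-< f))

  private
    ∈₂-diag : ∀ {x y : Fin n} → x ∈₂ (y , y) → x ≡ y
    ∈₂-diag (inj₁ x≡y) = x≡y
    ∈₂-diag (inj₂ x≡y) = x≡y

  ≐₂-adj : ∀ {e x y} → ends e ≐₂ (x , y) → Adj x y
  ≐₂-adj {e} ((u∈ , v∈) , (x∈ , y∈)) with x∈ | y∈
  ... | inj₁ refl | inj₁ refl = ⊥-elim (ends-≢ e (sym (∈₂-diag v∈)))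
  ... | inj₁ refl | inj₂ refl = ends-adj e
  ... | inj₂ refl | inj₁ refl = adj-sym (ends-adj e)
  ... | inj₂ refl | inj₂ refl = ⊥-elim (ends-≢ e (∈₂-diag u∈))

  ≐₂-≢ : ∀ {e x y} → ends e ≐₂ (x , y) → x ≢ y
  ≐₂-≢ {e} e≐ = adj⇒≢ (≐₂-adj {e} e≐)

  ≐₂-other-end : ∀ {e z x y} → ends e ≐₂ (z , x) → ends e ≐₂ (z , y) → x ≡ y
  ≐₂-other-end {e} e≐zx@(_ , (_ , x∈)) (⊆zy , _) with ⊆₂-∈ ⊆zy x∈
  ... | inj₁ x≡z = ⊥-elim (≐₂-≢ {e} e≐zx (sym x≡z))
  ... | inj₂ x≡y = x≡y

  ≐₂-within : ∀ {e x y} {P : Fin n → Set} → ends e ≐₂ (x , y) → P x → P y → ∀ {z} → z ∈ₑ e → P z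
  ≐₂-within (e⊆ , _) px py z∈e with ⊆₂-∈ e⊆ z∈e
  ... | inj₁ refl = px
  ... | inj₂ refl = py

  other-end : ∀ {z} e → z ∈ₑ e → ∃ λ x → ends e ≐₂ (z , x)
  other-end (edge u v _) end₁ = v , (end₁ , end₂) , (end₁ , end₂)
  other-end (edge u v _) end₂ = u , (end₂ , end₁) , (end₂ , end₁)

  ≐₂-edge : ∀ e f {P} → ends e ≐₂ P → ends f ≐₂ P → e ≡ f
  ≐₂-edge e f (e⊆P , P⊆e) (f⊆P , P⊆f) = edge-≐ e f (⊆₂-trans e⊆P P⊆f , ⊆₂-trans f⊆P P⊆e)

  ≐₂-swap : ∀ {e x y} → ends e ≐₂ (x , y) → ends e ≐₂ (y , x)
  ≐₂-swap ((u∈ , v∈) , (x∈ , y∈)) = (Sum.swap u∈ , Sum.swap v∈) , (y∈ , x∈)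

  ≐₂-intro : ∀ e {x y} → x ∈ₑ e → y ∈ₑ e → x ≢ y → ends e ≐₂ (x , y)
  ≐₂-intro (edge u v _) end₁ end₁ x≢y = ⊥-elim (x≢y refl)
  ≐₂-intro (edge u v _) end₁ end₂ _ = (end₁ , end₂) , (end₁ , end₂)
  ≐₂-intro (edge u v _) end₂ end₁ _ = (end₂ , end₁) , (end₂ , end₁)
  ≐₂-intro (edge u v _) end₂ end₂ x≢y = ⊥-elim (x≢y refl)

  ends-≐₂ : ∀ e → ends e ≐₂ ends e
  ends-≐₂ e = (end₁ , end₂) , (end₁ , end₂)

  edge-between : ∀ {x y} → Adj x y → Σ E λ e → ends e ≐₂ (x , y)
  edge-between {x} {y} xy with <-cmp (toℕ x) (toℕ y)
  ... | tri< x<y _ _ = edge x y (Equivalence.from T-∧ (<⇒<ᵇ x<y , xy)) , (end₁ , end₂) , (end₁ , end₂)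
  ... | tri≈ _ x≡y _ = ⊥-elim (adj⇒≢ xy (toℕ-injective x≡y))
  ... | tri> _ _ y<x = edge y x (Equivalence.from T-∧ (<⇒<ᵇ y<x , adj-sym xy)) , (end₂ , end₁) , (end₂ , end₁)

  LAdj : E → E → Set
  LAdj e f = T (adjᴸ e f)

  LAdj⇔ : ∀ e f → LAdj e f ⇔ (e ≢ f × ∃ λ z → z ∈ₑ e × z ∈ₑ f)
  LAdj⇔ e@(edge u v _) f@(edge u′ v′ _) with e ≟ᵉ f
  ... | yes e≡f = mk⇔ (λ ()) (λ (e≢f , _) → e≢f e≡f)
  ... | no e≢f = mk⇔ (λ h → e≢f , to (Equivalence.to split (subst T regroup h)))
                     (subst T (sym regroup) ∘ Equivalence.from split ∘ from ∘ proj₂)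
    where
    _∈f : Fin n → Bool
    z ∈f = ∈₂ᵇ F._≟_ z (ends f)
    split = T-∨ {u ∈f} {v ∈f}
    regroup : ⌊ u F.≟ u′ ⌋ ∨ ⌊ u F.≟ v′ ⌋ ∨ ⌊ v F.≟ u′ ⌋ ∨ ⌊ v F.≟ v′ ⌋ ≡ u ∈f ∨ v ∈f
    regroup = sym (∨-assoc ⌊ u F.≟ u′ ⌋ ⌊ u F.≟ v′ ⌋ _)
    to : T (u ∈f) ⊎ T (v ∈f) → ∃ λ z → z ∈ₑ e × z ∈ₑ f
    to (inj₁ p) = u , end₁ , Equivalence.to (T-∈₂ᵇ F._≟_ (ends f)) p
    to (inj₂ p) = v , end₂ , Equivalence.to (T-∈₂ᵇ F._≟_ (ends f)) p
    from : (∃ λ z → z ∈ₑ e × z ∈ₑ f) → T (u ∈f) ⊎ T (v ∈f)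
    from (_ , end₁ , z∈f) = inj₁ (Equivalence.from (T-∈₂ᵇ F._≟_ (ends f)) z∈f)
    from (_ , end₂ , z∈f) = inj₂ (Equivalence.from (T-∈₂ᵇ F._≟_ (ends f)) z∈f)

  spokes-adj : ∀ e f {z x y} → ends e ≐₂ (z , x) → ends f ≐₂ (z , y) → x ≢ y → LAdj e f
  spokes-adj e f e≐ f≐ x≢y = Equivalence.from (LAdj⇔ e f)
    ( (λ { refl → x≢y (≐₂-other-end {e} e≐ f≐) })
    , _ , proj₁ (proj₂ e≐) , proj₁ (proj₂ f≐))

  private
    LexEdge : E → E → Set
    LexEdge e f = toℕ (Edge.u e) < toℕ (Edge.u f) ⊎ (Edge.u e ≡ Edge.u f × toℕ (Edge.v e) < toℕ (Edge.v f))

    <ᴸ⇔Lex : ∀ e f → T (e <ᴸ f) ⇔ LexEdge e f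
    <ᴸ⇔Lex (edge u v _) (edge u′ v′ _) = mk⇔
      (Sum.map (<ᵇ⇒< _ _) (λ h → let (p , q) = Equivalence.to (T-∧ {⌊ u F.≟ u′ ⌋}) h in toWitness p , <ᵇ⇒< _ _ q)
        ∘ Equivalence.to (T-∨ {toℕ u <ᵇ toℕ u′}))
      (Equivalence.from (T-∨ {toℕ u <ᵇ toℕ u′})
        ∘ Sum.map <⇒<ᵇ (λ (p , q) → Equivalence.from (T-∧ {⌊ u F.≟ u′ ⌋}) (fromWitness p , <⇒<ᵇ q)))

    Lex-irrefl : ∀ {e} → ¬ LexEdge e e
    Lex-irrefl (inj₁ u<u) = <-irrefl refl u<u
    Lex-irrefl (inj₂ (_ , v<v)) = <-irrefl refl v<v

    Lex-trans : ∀ {e f g} → LexEdge e f → LexEdge f g → LexEdge e g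
    Lex-trans (inj₁ p) (inj₁ q) = inj₁ (<-trans p q)
    Lex-trans (inj₁ p) (inj₂ (refl , _)) = inj₁ p
    Lex-trans (inj₂ (refl , _)) (inj₁ q) = inj₁ q
    Lex-trans (inj₂ (refl , p)) (inj₂ (refl , q)) = inj₂ (refl , <-trans p q)

    Lex-total : ∀ {e f} → e ≢ f → LexEdge e f ⊎ LexEdge f e
    Lex-total {e@(edge u v _)} {f@(edge u′ v′ _)} e≢f with <-cmp (toℕ u) (toℕ u′) | <-cmp (toℕ v) (toℕ v′)
    ... | tri< p _ _ | _ = inj₁ (inj₁ p)
    ... | tri> _ _ p | _ = inj₂ (inj₁ p)
    ... | tri≈ _ p _ | tri< q _ _ = inj₁ (inj₂ (toℕ-injective p , q))
    ... | tri≈ _ p _ | tri> _ _ q = inj₂ (inj₂ (sym (toℕ-injective p) , q))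
    ... | tri≈ _ p _ | tri≈ _ q _ = ⊥-elim (e≢f (edge-≐ e f ((inj₁ (toℕ-injective p) , inj₂ (toℕ-injective q)) ,
                                                          (inj₁ (sym (toℕ-injective p)) , inj₂ (sym (toℕ-injective q))))))

  lineLaws : OGraphLaws (L Γ)
  lineLaws = record
    { <ᵒ-irrefl = λ {e} → Lex-irrefl {e} ∘ Equivalence.to (<ᴸ⇔Lex e e)
    ; <ᵒ-trans = λ {e} {f} {g} p q → Equivalence.from (<ᴸ⇔Lex e g)
                   (Lex-trans {e} {f} {g} (Equivalence.to (<ᴸ⇔Lex e f) p) (Equivalence.to (<ᴸ⇔Lex f g) q))
    ; <ᵒ-total = λ {e} {f} → Sum.map (Equivalence.from (<ᴸ⇔Lex e f)) (Equivalence.from (<ᴸ⇔Lex f e)) ∘ Lex-total {e} {f}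
    ; adj-irrefl = λ {e} h → proj₁ (Equivalence.to (LAdj⇔ e e) h) refl
    ; adj-sym = λ {e} {f} h → let (e≢f , z , z∈e , z∈f) = Equivalence.to (LAdj⇔ e f) h in
                  Equivalence.from (LAdj⇔ f e) (e≢f ∘ sym , z , z∈f , z∈e)
    }

finLaws : ∀ {n} (Γ : FinGraph n) → OGraphLaws (finO Γ)
finLaws {n} Γ = record
  { <ᵒ-irrefl = λ {x} → <-irrefl refl ∘ <ᵇ⇒< (toℕ x) (toℕ x)
  ; <ᵒ-trans = λ {x} {y} {z} p q → <⇒<ᵇ (<-trans (<ᵇ⇒< (toℕ x) (toℕ y) p) (<ᵇ⇒< (toℕ y) (toℕ z) q))
  ; <ᵒ-total = total
  ; adj-irrefl = λ h → Edges.adj⇒≢ Γ h refl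
  ; adj-sym = Edges.adj-sym Γ
  }
  where
  total : ∀ {x y : Fin n} → x ≢ y → T (toℕ x <ᵇ toℕ y) ⊎ T (toℕ y <ᵇ toℕ x)
  total {x} {y} x≢y with <-cmp (toℕ x) (toℕ y)
  ... | tri< p _ _ = inj₁ (<⇒<ᵇ p)
  ... | tri≈ _ p _ = ⊥-elim (x≢y (toℕ-injective p))
  ... | tri> _ _ p = inj₂ (<⇒<ᵇ p)

relation⇒≅ : ∀ G H (R : Graph.V G → Graph.V H → Set) →
             (∀ x → ∃ (R x)) → (∀ y → ∃ λ x → R x y) →
             (∀ {x y y′} → R x y → R x y′ → y ≡ y′) → (∀ {x x′ y} → R x y → R x′ y → x ≡ x′) →
             (∀ {x x′ y y′} → R x y → R x′ y′ → Graph.adj G x x′ ≡ Graph.adj H y y′) → G ≅ H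
relation⇒≅ G H R total onto functional injective adj-resp =
  mk↔ₛ′ to from to-from from-to , λ x x′ → adj-resp (proj₂ (total x)) (proj₂ (total x′))
  where
  to : Graph.V G → Graph.V H
  to x = proj₁ (total x)
  from : Graph.V H → Graph.V G
  from y = proj₁ (onto y)
  to-from : ∀ y → to (from y) ≡ y
  to-from y = functional (proj₂ (total (from y))) (proj₂ (onto y))
  from-to : ∀ x → from (to x) ≡ x
  from-to x = injective (proj₂ (onto (to x))) (proj₂ (total x))

-- Finite sums over Fin n

𝟙 : Bool → ℕ
𝟙 b = if b then 1 else 0

∑-zero : ∀ {n} {f : Fin n → ℕ} → (∀ i → f i ≡ 0) → sum f ≡ 0
∑-zero {zero} _ = refl
∑-zero {suc n} f≗0 = cong₂ _+_ (f≗0 zero) (∑-zero (f≗0 ∘ suc))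

∑-mono-≤ : ∀ {n} {f g : Fin n → ℕ} → (∀ i → f i ≤ g i) → sum f ≤ sum g
∑-mono-≤ {zero} _ = z≤n
∑-mono-≤ {suc n} f≤g = +-mono-≤ (f≤g zero) (∑-mono-≤ (f≤g ∘ suc))

term≤∑ : ∀ {n} (f : Fin n → ℕ) i → f i ≤ sum f
term≤∑ f zero = m≤m+n (f zero) _
term≤∑ f (suc i) = ≤-trans (term≤∑ (f ∘ suc) i) (m≤n+m _ (f zero))

∑-const : ∀ n c → ∑[ i < n ] c ≡ n * c
∑-const zero c = refl
∑-const (suc n) c = cong (c +_) (∑-const n c)

∑-≤-pointwise-≡ : ∀ {n} {f g : Fin n → ℕ} → (∀ i → f i ≤ g i) → sum f ≡ sum g → ∀ i → f i ≡ g i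
∑-≤-pointwise-≡ {suc n} {f} {g} f≤g eq zero =
  ≤-antisym (f≤g zero) (+-cancelʳ-≤ (sum (f ∘ suc)) (g zero) (f zero)
    (≤-trans (+-monoʳ-≤ (g zero) (∑-mono-≤ (f≤g ∘ suc))) (≤-reflexive (sym eq))))
∑-≤-pointwise-≡ {suc n} {f} {g} f≤g eq (suc i) = ∑-≤-pointwise-≡ (f≤g ∘ suc)
  (≤-antisym (∑-mono-≤ (f≤g ∘ suc))
             (+-cancelˡ-≤ (f zero) _ _ (≤-trans (+-monoˡ-≤ (sum (g ∘ suc)) (f≤g zero)) (≤-reflexive (sym eq))))) i

∑-positive : ∀ {n} (f : Fin n → ℕ) → 0 < sum f → ∃ λ i → 0 < f i
∑-positive {suc n} f pos with f zero in eq
... | suc _ = zero , subst (0 <_) (sym eq) (s≤s z≤n)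
... | zero = let (i , fi>0) = ∑-positive (f ∘ suc) pos in suc i , fi>0

∑-δ : ∀ {n} (a : Fin n) (h : Fin n → ℕ) → ∑[ i < n ] (if ⌊ i F.≟ a ⌋ then h i else 0) ≡ h a
∑-δ {suc n} zero h = trans (cong (h zero +_) (∑-zero {n} λ _ → refl)) (+-identityʳ (h zero))
∑-δ {suc n} (suc a) h = trans (sum-cong-≗ suc-≟) (∑-δ a (h ∘ suc))
  where
  suc-≟ : ∀ i → (if ⌊ suc i F.≟ suc a ⌋ then h (suc i) else 0) ≡ (if ⌊ i F.≟ a ⌋ then h (suc i) else 0)
  suc-≟ i with i F.≟ a
  ... | yes _ = refl
  ... | no _ = refl

sum-map-allFin : ∀ {n} (f : Fin n → ℕ) → List.sum (map f (allFin n)) ≡ sum f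
sum-map-allFin {n} f = trans (cong List.sum (map-tabulate (λ i → i) f)) (sum-tabulate n f)
  where
  sum-tabulate : ∀ m (g : Fin m → ℕ) → List.sum (tabulate g) ≡ sum g
  sum-tabulate zero g = refl
  sum-tabulate (suc m) g = cong (g zero +_) (sum-tabulate m (g ∘ suc))

T⇒𝟙≡1 : ∀ {b} → T b → 𝟙 b ≡ 1
T⇒𝟙≡1 {true} _ = refl

+-tight : ∀ {m n a b} → m ≤ a → n ≤ b → m + n ≡ a + b → m ≡ a × n ≡ b
+-tight {m} {n} {a} {b} m≤a n≤b eq = m≡a , +-cancelˡ-≡ a n b (subst (λ k → k + n ≡ a + b) m≡a eq)
  where
  m≡a : m ≡ a
  m≡a = ≤-antisym m≤a (+-cancelʳ-≤ b a m (≤-trans (≤-reflexive (sym eq)) (+-monoʳ-≤ m n≤b)))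

𝟙*𝟙-positive : ∀ {p q} → 0 < 𝟙 p * 𝟙 q → T p × T q
𝟙*𝟙-positive {true} {true} _ = tt , tt

at-most-one : ∀ p q r → ¬ (T p × T q) → ¬ (T p × T r) → ¬ (T q × T r) → 𝟙 p + 𝟙 q + 𝟙 r ≤ 1
at-most-one true true _ ¬pq _ _ = ⊥-elim (¬pq (tt , tt))
at-most-one true false true _ ¬pr _ = ⊥-elim (¬pr (tt , tt))
at-most-one true false false _ _ _ = s≤s z≤n
at-most-one false true true _ _ ¬qr = ⊥-elim (¬qr (tt , tt))
at-most-one false true false _ _ _ = s≤s z≤n
at-most-one false false true _ _ _ = s≤s z≤n
at-most-one false false false _ _ _ = z≤n

exactly-one : ∀ {A : Set} (p : A → Bool) {a b c} → 𝟙 (p a) + 𝟙 (p b) + 𝟙 (p c) ≡ 1 →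
              ∃ λ v → v ∈₃ (a , b , c) × T (p v) × ∀ {w} → w ∈₃ (a , b , c) → T (p w) → w ≡ v
exactly-one p {a} {b} {c} sum≡1 with p a in pa | p b in pb | p c in pc
... | true | false | false = a , 1st , subst T (sym pa) tt ,
  λ { 1st _ → refl ; 2nd pw → ⊥-elim (subst T pb pw) ; 3rd pw → ⊥-elim (subst T pc pw) }
... | false | true | false = b , 2nd , subst T (sym pb) tt ,
  λ { 1st pw → ⊥-elim (subst T pa pw) ; 2nd _ → refl ; 3rd pw → ⊥-elim (subst T pc pw) }
... | false | false | true = c , 3rd , subst T (sym pc) tt ,
  λ { 1st pw → ⊥-elim (subst T pa pw) ; 2nd pw → ⊥-elim (subst T pb pw) ; 3rd _ → refl }
... | false | false | false with () ← sum≡1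
... | true | true | _ with () ← sum≡1
... | true | false | true with () ← sum≡1
... | false | true | true with () ← sum≡1

module _ {A : Set} where

  private
    length-insert : ∀ (ys zs : List A) {x} → length (ys ++ x ∷ zs) ≡ suc (length (ys ++ zs))
    length-insert [] zs = refl
    length-insert (y ∷ ys) zs = cong suc (length-insert ys zs)

    ∈-delete : ∀ (ys : List A) {zs x y} → y ∈ ys ++ x ∷ zs → x ≢ y → y ∈ ys ++ zs
    ∈-delete [] (here refl) x≢y = ⊥-elim (x≢y refl)
    ∈-delete [] (there y∈zs) _ = y∈zs
    ∈-delete (_ ∷ ys) (here y≡) _ = here y≡
    ∈-delete (_ ∷ ys) (there y∈) x≢y = there (∈-delete ys y∈ x≢y)

  unique-⊆⇒length≤ : ∀ {xs ys : List A} → Unique xs → (∀ {x} → x ∈ xs → x ∈ ys) → length xs ≤ length ys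
  unique-⊆⇒length≤ {[]} _ _ = z≤n
  unique-⊆⇒length≤ {x ∷ xs} (x∉xs ∷ xs!) xs⊆ys with ∈-∃++ (xs⊆ys (here refl))
  ... | ys₁ , ys₂ , refl = subst (suc (length xs) ≤_) (sym (length-insert ys₁ ys₂))
    (s≤s (unique-⊆⇒length≤ xs! (λ y∈xs → ∈-delete ys₁ (xs⊆ys (there y∈xs)) (All.lookup x∉xs y∈xs))))

-- Degrees

module Degree {n : ℕ} (Γ : FinGraph n) where
  open Edges Γ
  open DecMembership (F._≟_ {n}) using (_∈?_)

  neighbours : Fin n → List (Fin n)
  neighbours v = filter (λ w → T? (edge? Γ v w)) (allFin n)

  ∈-neighbours⁺ : ∀ {v w} → Adj v w → w ∈ neighbours v
  ∈-neighbours⁺ {v} vw = ∈-filter⁺ (λ w → T? (edge? Γ v w)) (∈-allFin _) vw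

  ∈-neighbours⁻ : ∀ {v w} → w ∈ neighbours v → Adj v w
  ∈-neighbours⁻ {v} w∈ = proj₂ (∈-filter⁻ (λ w → T? (edge? Γ v w)) {xs = allFin n} w∈)

  neighbours-unique : ∀ v → Unique (neighbours v)
  neighbours-unique v = Unique.filter⁺ (λ w → T? (edge? Γ v w)) (Unique.allFin⁺ n)

  length-neighbours : ∀ v → length (neighbours v) ≡ deg Γ v
  length-neighbours v = sym (count (allFin n))
    where
    count : ∀ ws → List.sum (map (λ w → if edge? Γ v w then 1 else 0) ws) ≡ length (filter (λ w → T? (edge? Γ v w)) ws)
    count [] = refl
    count (w ∷ ws) with edge? Γ v w
    ... | true = cong suc (count ws)
    ... | false = count ws

  deg≡∑ : ∀ v → deg Γ v ≡ ∑[ w < n ] 𝟙 (edge? Γ v w)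
  deg≡∑ v = sum-map-allFin (λ w → 𝟙 (edge? Γ v w))

  unique-neighbours≤deg : ∀ {v xs} → Unique xs → All (Adj v) xs → length xs ≤ deg Γ v
  unique-neighbours≤deg {v} xs! adj = subst (_ ≤_) (length-neighbours v)
    (unique-⊆⇒length≤ xs! (∈-neighbours⁺ ∘ All.lookup adj))

  outside-neighbour : ∀ {v} xs → length xs < deg Γ v → ∃ λ w → Adj v w × w ∉ xs
  outside-neighbour {v} xs xs<deg with all? (_∈? xs) (neighbours v)
  ... | yes N⊆xs = ⊥-elim (<-irrefl refl (<-≤-trans xs<deg (subst (_≤ length xs) (length-neighbours v)
                      (unique-⊆⇒length≤ (neighbours-unique v) (All.lookup N⊆xs)))))
  ... | no N⊈xs = let (w , w∈N , w∉xs) = find (AllProperties.¬All⇒Any¬ (_∈? xs) _ N⊈xs) in w , ∈-neighbours⁻ w∈N , w∉xs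

  ∈-when-deg≤ : ∀ {v xs} → Unique xs → All (Adj v) xs → deg Γ v ≤ length xs → ∀ {u} → Adj v u → u ∈ xs
  ∈-when-deg≤ {v} {xs} xs! adj deg≤ {u} vu with u ∈? xs
  ... | yes u∈xs = u∈xs
  ... | no u∉xs = ⊥-elim (<-irrefl refl (≤-trans (unique-neighbours≤deg (u∉xs′ ∷ xs!) (vu ∷ adj)) deg≤))
    where
    u∉xs′ : All (u ≢_) xs
    u∉xs′ = All.tabulate λ y∈xs u≡y → u∉xs (subst (_∈ xs) (sym u≡y) y∈xs)

module Cliques {n : ℕ} (Γ : FinGraph n) where
  open Edges Γ
  open Degree Γ
  open DecMembership (F._≟_ {n}) using (_∈?_)

  walk-closed : ∀ (P : Fin n → Set) → (∀ {u v} → P u → Adj u v → P v) → ∀ {x y} → P x → Walk Γ x y → P y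
  walk-closed P closed px here = px
  walk-closed P closed px (step xw walk) = walk-closed P closed (closed px xw) walk

  clique-adj : ∀ {Y} → AllPairs Adj Y → ∀ {u v} → u ∈ Y → v ∈ Y → u ≢ v → Adj u v
  clique-adj (_ ∷ _) (here refl) (here refl) u≢v = ⊥-elim (u≢v refl)
  clique-adj (u∼ ∷ _) (here refl) (there v∈Y) _ = All.lookup u∼ v∈Y
  clique-adj (v∼ ∷ _) (there u∈Y) (here refl) _ = adj-sym (All.lookup v∼ u∈Y)
  clique-adj (_ ∷ Y∼) (there u∈Y) (there v∈Y) u≢v = clique-adj Y∼ u∈Y v∈Y u≢v

  -- u together with its neighbours would contain v ∷ Y, which is one vertex too many.
  clique-closed : ∀ {Y} → AllPairs Adj Y → (∀ {u} → u ∈ Y → deg Γ u < length Y) →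
                  ∀ {u v} → u ∈ Y → Adj u v → v ∈ Y
  clique-closed {Y} Y∼ small {u} {v} u∈Y uv with v ∈? Y
  ... | yes v∈Y = v∈Y
  ... | no v∉Y = ⊥-elim (<-irrefl refl (≤-trans (s≤s too-many) (small u∈Y)))
    where
    Y! : Unique Y
    Y! = AllPairs.map adj⇒≢ Y∼
    covered : ∀ {z} → z ∈ v ∷ Y → z ∈ u ∷ neighbours u
    covered (here refl) = there (∈-neighbours⁺ uv)
    covered {z} (there z∈Y) with z F.≟ u
    ... | yes refl = here refl
    ... | no z≢u = there (∈-neighbours⁺ (clique-adj Y∼ u∈Y z∈Y (z≢u ∘ sym)))
    too-many : length Y ≤ deg Γ u
    too-many = subst (length Y ≤_) (length-neighbours u)
      (≤-pred (unique-⊆⇒length≤ (All.tabulate (λ z∈Y v≡z → v∉Y (subst (_∈ Y) (sym v≡z) z∈Y)) ∷ Y!) covered))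

  connected-clique : Connected Γ → ∀ {y Y} → AllPairs Adj (y ∷ Y) → (∀ {u} → u ∈ y ∷ Y → deg Γ u < suc (length Y)) →
                     ∀ v → v ∈ y ∷ Y
  connected-clique conn Y∼ small v = walk-closed (_∈ _) (clique-closed Y∼ small) (here refl) (conn _ v)

module LineTriangles {n : ℕ} (Γ : FinGraph n) where
  open Edges Γ public
  open Degree Γ public
  module TL = TriangleProperties (L Γ) lineLaws
  module TΓ = TriangleProperties (finO Γ) (finLaws Γ)

  three-neighbours⇒3≤deg : ∀ {v x y w} → Adj v x → Adj v y → Adj v w → x ≢ y → y ≢ w → x ≢ w → 3 ≤ deg Γ v
  three-neighbours⇒3≤deg vx vy vw x≢y y≢w x≢w =
    unique-neighbours≤deg ((x≢y ∷ x≢w ∷ []) ∷ (y≢w ∷ []) ∷ [] ∷ []) (vx ∷ vy ∷ vw ∷ [])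

  edge-within₃ : ∀ e {p q r e₁ e₂ e₃} → Edge.u e ∈₃ (p , q , r) → Edge.v e ∈₃ (p , q , r) →
                 ends e₁ ≐₂ (p , q) → ends e₂ ≐₂ (p , r) → ends e₃ ≐₂ (q , r) → e ∈₃ (e₁ , e₂ , e₃)
  edge-within₃ e u∈ v∈ e₁≐ e₂≐ e₃≐ with u∈ | v∈
  ... | inj₁ u≡p | inj₁ v≡p = ⊥-elim (ends-≢ e (trans u≡p (sym v≡p)))
  ... | inj₂ (inj₁ u≡q) | inj₂ (inj₁ v≡q) = ⊥-elim (ends-≢ e (trans u≡q (sym v≡q)))
  ... | inj₂ (inj₂ u≡r) | inj₂ (inj₂ v≡r) = ⊥-elim (ends-≢ e (trans u≡r (sym v≡r)))
  ... | 1st | 2nd = inj₁ (≐₂-edge e _ (ends-≐₂ e) e₁≐)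
  ... | 2nd | 1st = inj₁ (≐₂-edge e _ (≐₂-swap {e} (ends-≐₂ e)) e₁≐)
  ... | 1st | 3rd = inj₂ (inj₁ (≐₂-edge e _ (ends-≐₂ e) e₂≐))
  ... | 3rd | 1st = inj₂ (inj₁ (≐₂-edge e _ (≐₂-swap {e} (ends-≐₂ e)) e₂≐))
  ... | 2nd | 3rd = inj₂ (inj₂ (≐₂-edge e _ (ends-≐₂ e) e₃≐))
  ... | 3rd | 2nd = inj₂ (inj₂ (≐₂-edge e _ (≐₂-swap {e} (ends-≐₂ e)) e₃≐))

  -- The two kinds of triangles of L Γ

  record Star (X : Triangle (L Γ)) (z : Fin n) (ℓ : Fin n × Fin n × Fin n) : Set where
    field
      leaf-adj : ∀ {u} → u ∈₃ ℓ → Adj z u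
      ∈⇔spoke : ∀ e → e ∈ᵗ X ⇔ (∃ λ u → u ∈₃ ℓ × ends e ≐₂ (z , u))

  record SidesOf (X : Triangle (L Γ)) (t : Triangle (finO Γ)) : Set where
    constructor sides
    field
      ∈⇔⊆ : ∀ e → e ∈ᵗ X ⇔ (∀ {z} → z ∈ₑ e → z ∈ᵗ t)

  star-from : ∀ {X z x y w e₁ e₂ e₃} → ends e₁ ≐₂ (z , x) → ends e₂ ≐₂ (z , y) → ends e₃ ≐₂ (z , w) →
              TL.vertices X ≐₃ (e₁ , e₂ , e₃) → Star X z (x , y , w)
  star-from {X} {e₁ = e₁} {e₂} {e₃} e₁≐ e₂≐ e₃≐ X≐ = record { leaf-adj = leaf-adj ; ∈⇔spoke = λ e → mk⇔ (to e) (from e) }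
    where
    leaf-adj : ∀ {u} → u ∈₃ _ → Adj _ u
    leaf-adj 1st = ≐₂-adj {e₁} e₁≐
    leaf-adj 2nd = ≐₂-adj {e₂} e₂≐
    leaf-adj 3rd = ≐₂-adj {e₃} e₃≐
    to : ∀ e → e ∈ᵗ X → ∃ λ u → u ∈₃ _ × ends e ≐₂ (_ , u)
    to e e∈X with Equivalence.to (TL.∈ᵗ⇔ X X≐) e∈X
    ... | 1st = _ , 1st , e₁≐
    ... | 2nd = _ , 2nd , e₂≐
    ... | 3rd = _ , 3rd , e₃≐
    from : ∀ e → (∃ λ u → u ∈₃ _ × ends e ≐₂ (_ , u)) → e ∈ᵗ X
    from e (_ , 1st , e≐) = Equivalence.from (TL.∈ᵗ⇔ X X≐) (inj₁ (≐₂-edge e e₁ e≐ e₁≐))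
    from e (_ , 2nd , e≐) = Equivalence.from (TL.∈ᵗ⇔ X X≐) (inj₂ (inj₁ (≐₂-edge e e₂ e≐ e₂≐)))
    from e (_ , 3rd , e≐) = Equivalence.from (TL.∈ᵗ⇔ X X≐) (inj₂ (inj₂ (≐₂-edge e e₃ e≐ e₃≐)))

  sides-from : ∀ {X t p q r e₁ e₂ e₃} → ends e₁ ≐₂ (p , q) → ends e₂ ≐₂ (p , r) → ends e₃ ≐₂ (q , r) →
               TL.vertices X ≐₃ (e₁ , e₂ , e₃) → TΓ.vertices t ≐₃ (p , q , r) → SidesOf X t
  sides-from {X} {t} e₁≐ e₂≐ e₃≐ X≐ t≐ = sides λ e → mk⇔ (to e) (from e)
    where
    ⊆t = proj₂ t≐
    to : ∀ e → e ∈ᵗ X → ∀ {z} → z ∈ₑ e → z ∈ᵗ t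
    to e e∈X with Equivalence.to (TL.∈ᵗ⇔ X X≐) e∈X
    ... | 1st = ≐₂-within {e} e₁≐ (proj₁ ⊆t) (proj₁ (proj₂ ⊆t))
    ... | 2nd = ≐₂-within {e} e₂≐ (proj₁ ⊆t) (proj₂ (proj₂ ⊆t))
    ... | 3rd = ≐₂-within {e} e₃≐ (proj₁ (proj₂ ⊆t)) (proj₂ (proj₂ ⊆t))
    from : ∀ e → (∀ {z} → z ∈ₑ e → z ∈ᵗ t) → e ∈ᵗ X
    from e e⊆t = Equivalence.from (TL.∈ᵗ⇔ X X≐)
      (edge-within₃ e (Equivalence.to (TΓ.∈ᵗ⇔ t t≐) (e⊆t end₁)) (Equivalence.to (TΓ.∈ᵗ⇔ t t≐) (e⊆t end₂)) e₁≐ e₂≐ e₃≐)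

  star : ∀ {z x y w} → Adj z x → Adj z y → Adj z w → x ≢ y → y ≢ w → x ≢ w →
         Σ (Triangle (L Γ)) λ X → Star X z (x , y , w)
  star zx zy zw x≢y y≢w x≢w =
    X , star-from {X} {e₁ = eˣ} {eʸ} {eʷ} eˣ≐ eʸ≐ eʷ≐ X≐
    where
    eˣ = proj₁ (edge-between zx)
    eˣ≐ = proj₂ (edge-between zx)
    eʸ = proj₁ (edge-between zy)
    eʸ≐ = proj₂ (edge-between zy)
    eʷ = proj₁ (edge-between zw)
    eʷ≐ = proj₂ (edge-between zw)
    X′ = TL.triangle (spokes-adj eˣ eʸ eˣ≐ eʸ≐ x≢y) (spokes-adj eʸ eʷ eʸ≐ eʷ≐ y≢w) (spokes-adj eˣ eʷ eˣ≐ eʷ≐ x≢w)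
    X = proj₁ X′
    X≐ = proj₂ X′

  sides-of : (t : Triangle (finO Γ)) → Σ (Triangle (L Γ)) λ X → SidesOf X t
  sides-of t = X , sides-from {X} {t} {e₁ = eᵃᵇ} {eᵃᶜ} {eᵇᶜ} eᵃᵇ≐ eᵃᶜ≐ eᵇᶜ≐ X≐ ≐₃-refl
    where
    eᵃᵇ = proj₁ (edge-between (TΓ.adj-ab t))
    eᵃᵇ≐ = proj₂ (edge-between (TΓ.adj-ab t))
    eᵃᶜ = proj₁ (edge-between (TΓ.adj-ac t))
    eᵃᶜ≐ = proj₂ (edge-between (TΓ.adj-ac t))
    eᵇᶜ = proj₁ (edge-between (TΓ.adj-bc t))
    eᵇᶜ≐ = proj₂ (edge-between (TΓ.adj-bc t))
    X′ = TL.triangle (spokes-adj eᵃᵇ eᵃᶜ eᵃᵇ≐ eᵃᶜ≐ (TΓ.<ᵒ⇒≢ (TΓ.b<c t)))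
                     (spokes-adj eᵃᶜ eᵇᶜ (≐₂-swap {eᵃᶜ} eᵃᶜ≐) (≐₂-swap {eᵇᶜ} eᵇᶜ≐) (TΓ.<ᵒ⇒≢ (TΓ.a<b t)))
                     (spokes-adj eᵃᵇ eᵇᶜ (≐₂-swap {eᵃᵇ} eᵃᵇ≐) eᵇᶜ≐ (TΓ.<ᵒ⇒≢ (TΓ.a<c t)))
    X = proj₁ X′
    X≐ = proj₂ X′

  private
    far-end-on : ∀ e f {z x} → ends e ≐₂ (z , x) → LAdj e f → ¬ z ∈ₑ f → x ∈ₑ f
    far-end-on e f (e⊆ , _) ef z∉f with Equivalence.to (LAdj⇔ e f) ef
    ... | _ , z′ , z′∈e , z′∈f with ⊆₂-∈ e⊆ z′∈e
    ... | inj₁ refl = ⊥-elim (z∉f z′∈f)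
    ... | inj₂ refl = z′∈f

  -- Two sides of X meet in a vertex z; the third side either passes through z or joins their other ends.
  classify : ∀ X → (∃₂ λ z ℓ → Star X z ℓ) ⊎ (∃ λ t → SidesOf X t)
  classify X@(tri a b c _) with Equivalence.to (LAdj⇔ a b) (TL.adj-ab X)
  ... | a≢b , z , z∈a , z∈b with other-end a z∈a | other-end b z∈b | z ∈ₑ? c
  ... | x , a≐ | y , b≐ | yes z∈c =
    let (w , c≐) = other-end c z∈c in inj₁ (z , (x , y , w) , star-from {X} {e₁ = a} {b} {c} a≐ b≐ c≐ ≐₃-refl)
  ... | x , a≐ | y , b≐ | no z∉c =
    inj₂ (proj₁ t′ , sides-from {X} {proj₁ t′} {e₁ = a} {b} {c} a≐ b≐ c≐ ≐₃-refl (proj₂ t′))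
    where
    x≢y : x ≢ y
    x≢y refl = a≢b (≐₂-edge a b a≐ b≐)
    c≐ : ends c ≐₂ (x , y)
    c≐ = ≐₂-intro c (far-end-on a c a≐ (TL.adj-ac X) z∉c) (far-end-on b c b≐ (TL.adj-bc X) z∉c) x≢y
    t′ = TΓ.triangle (≐₂-adj {a} a≐) (≐₂-adj {c} c≐) (≐₂-adj {b} b≐)

  module StarProperties {X z ℓ} (s : Star X z ℓ) where
    open Star s

    centre∈ : ∀ {e} → e ∈ᵗ X → z ∈ₑ e
    centre∈ {e} e∈X = proj₁ (proj₂ (proj₂ (proj₂ (Equivalence.to (∈⇔spoke e) e∈X))))

    spoke : ∀ {u} → u ∈₃ ℓ → ∃ λ e → e ∈ᵗ X × ends e ≐₂ (z , u)
    spoke {u} u∈ℓ = let (e , e≐) = edge-between (leaf-adj u∈ℓ) in e , Equivalence.from (∈⇔spoke e) (u , u∈ℓ , e≐) , e≐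

    private
      leaf : ∀ {e} → e ∈ᵗ X → Fin n
      leaf {e} e∈X = proj₁ (Equivalence.to (∈⇔spoke e) e∈X)

      leaf-≐ : ∀ {e} (e∈X : e ∈ᵗ X) → ends e ≐₂ (z , leaf e∈X)
      leaf-≐ {e} e∈X = proj₂ (proj₂ (Equivalence.to (∈⇔spoke e) e∈X))

      adj-leaf : ∀ {e} (e∈X : e ∈ᵗ X) → Adj z (leaf e∈X)
      adj-leaf {e} e∈X = ≐₂-adj {e} (leaf-≐ e∈X)

      leaf-≢ : ∀ {e f} (e∈X : e ∈ᵗ X) (f∈X : f ∈ᵗ X) → e ≢ f → leaf e∈X ≢ leaf f∈X
      leaf-≢ {e} {f} e∈X f∈X e≢f u≡u′ =
        e≢f (≐₂-edge e f (leaf-≐ e∈X) (subst (λ u → ends f ≐₂ (z , u)) (sym u≡u′) (leaf-≐ f∈X)))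

      open Triangle X renaming (a to eᵃ; b to eᵇ; c to eᶜ)

      a∈X : eᵃ ∈ᵗ X
      a∈X = 1st
      b∈X : eᵇ ∈ᵗ X
      b∈X = 2nd
      c∈X : eᶜ ∈ᵗ X
      c∈X = 3rd

      leaves-distinct : leaf a∈X ≢ leaf b∈X × leaf b∈X ≢ leaf c∈X × leaf a∈X ≢ leaf c∈X
      leaves-distinct = leaf-≢ a∈X b∈X (TL.<ᵒ⇒≢ (TL.a<b X)) , leaf-≢ b∈X c∈X (TL.<ᵒ⇒≢ (TL.b<c X)) ,
                        leaf-≢ a∈X c∈X (TL.<ᵒ⇒≢ (TL.a<c X))

    3≤deg : 3 ≤ deg Γ z
    3≤deg = let (ab , bc , ac) = leaves-distinct in
      three-neighbours⇒3≤deg (adj-leaf a∈X) (adj-leaf b∈X) (adj-leaf c∈X) ab bc ac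

    deg≤3⇒spokes : deg Γ z ≤ 3 → ∀ {e} → z ∈ₑ e → e ∈ᵗ X
    deg≤3⇒spokes deg≤3 {e} z∈e with other-end e z∈e
    ... | u , e≐ with ∈-when-deg≤ ((proj₁ leaves-distinct ∷ proj₂ (proj₂ leaves-distinct) ∷ []) ∷
                                   (proj₁ (proj₂ leaves-distinct) ∷ []) ∷ [] ∷ [])
                         (adj-leaf a∈X ∷ adj-leaf b∈X ∷ adj-leaf c∈X ∷ []) deg≤3 (≐₂-adj {e} e≐)
    ... | here refl = subst (_∈ᵗ X) (≐₂-edge eᵃ e (leaf-≐ a∈X) e≐) a∈X
    ... | there (here refl) = subst (_∈ᵗ X) (≐₂-edge eᵇ e (leaf-≐ b∈X) e≐) b∈X
    ... | there (there (here refl)) = subst (_∈ᵗ X) (≐₂-edge eᶜ e (leaf-≐ c∈X) e≐) c∈X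

  record StarAt (X : Triangle (L Γ)) (z : Fin n) : Set where
    constructor spokes
    field
      ∈⇔∋ : ∀ e → e ∈ᵗ X ⇔ z ∈ₑ e

  star-at : ∀ {X z ℓ} → Star X z ℓ → deg Γ z ≤ 3 → StarAt X z
  star-at s deg≤3 = spokes λ e → mk⇔ (StarProperties.centre∈ s) (StarProperties.deg≤3⇒spokes s deg≤3)

  sides-edge : ∀ {X t x y} → SidesOf X t → x ∈ᵗ t → y ∈ᵗ t → x ≢ y → ∃ λ e → e ∈ᵗ X × ends e ≐₂ (x , y)
  sides-edge {X} {t} X=t x∈t y∈t x≢y =
    let (e , e≐) = edge-between (TΓ.∈ᵗ-adj t x∈t y∈t x≢y) in
    e , Equivalence.from (SidesOf.∈⇔⊆ X=t e) (≐₂-within {e} e≐ x∈t y∈t) , e≐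

  sides-unique : ∀ {X t t′} → SidesOf X t → SidesOf X t′ → t ≡ t′
  sides-unique {X} {t} {t′} X=t X=t′ = TΓ.triangle-ext t t′ (into X=t X=t′) (into X=t′ X=t)
    where
    into : ∀ {s s′} → SidesOf X s → SidesOf X s′ → ∀ {v} → v ∈ᵗ s → v ∈ᵗ s′
    into {s} X=s X=s′ v∈s =
      let (w , w∈s , v≢w) = TΓ.another-vertex s v∈s
          (e , e∈X , e≐) = sides-edge X=s v∈s w∈s v≢w
      in Equivalence.to (SidesOf.∈⇔⊆ X=s′ e) e∈X (proj₁ (proj₂ e≐))

  sides-no-centre : ∀ {X t v} → SidesOf X t → ¬ (∀ {e} → e ∈ᵗ X → v ∈ₑ e)
  sides-no-centre {X} {t} {v} X=t v∈ = on-all-sides (on-side 1st 2nd a≢b) (on-side 2nd 3rd b≢c) (on-side 1st 3rd a≢c)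
    where
    open Triangle t
    a≢b = TΓ.<ᵒ⇒≢ (TΓ.a<b t)
    b≢c = TΓ.<ᵒ⇒≢ (TΓ.b<c t)
    a≢c = TΓ.<ᵒ⇒≢ (TΓ.a<c t)
    on-side : ∀ {x y} → x ∈ᵗ t → y ∈ᵗ t → x ≢ y → v ∈₂ (x , y)
    on-side x∈t y∈t x≢y = let (e , e∈X , e≐) = sides-edge X=t x∈t y∈t x≢y in ⊆₂-∈ (proj₁ e≐) (v∈ e∈X)
    on-all-sides : v ∈₂ (a , b) → v ∈₂ (b , c) → v ∈₂ (a , c) → ⊥
    on-all-sides (inj₁ v≡a) (inj₁ v≡b) _ = a≢b (trans (sym v≡a) v≡b)
    on-all-sides (inj₁ v≡a) (inj₂ v≡c) _ = a≢c (trans (sym v≡a) v≡c)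
    on-all-sides (inj₂ v≡b) _ (inj₁ v≡a) = a≢b (trans (sym v≡a) v≡b)
    on-all-sides (inj₂ v≡b) _ (inj₂ v≡c) = b≢c (trans (sym v≡b) v≡c)

  star-not-sides : ∀ {X z ℓ t} → Star X z ℓ → ¬ SidesOf X t
  star-not-sides s X=t = sides-no-centre X=t (StarProperties.centre∈ s)

  common-vertex-unique : ∀ {X v w} → (∀ {e} → e ∈ᵗ X → v ∈ₑ e) → (∀ {e} → e ∈ᵗ X → w ∈ₑ e) → v ≡ w
  common-vertex-unique {X@(tri a b _ _)} {v} {w} v∈ w∈ with v F.≟ w
  ... | yes v≡w = v≡w
  ... | no v≢w = ⊥-elim (TL.<ᵒ⇒≢ (TL.a<b X) (≐₂-edge a b (≐₂-intro a (v∈ 1st) (w∈ 1st) v≢w) (≐₂-intro b (v∈ 2nd) (w∈ 2nd) v≢w)))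

  ThreeNeighbours : Fin n → Set
  ThreeNeighbours v = ∃ λ ((x , y , w) : Fin n × Fin n × Fin n) →
                      (Adj v x × Adj v y × Adj v w) × (x ≢ y × y ≢ w × x ≢ w)

  three-neighbours : ∀ {v} → 3 ≤ deg Γ v → ThreeNeighbours v
  three-neighbours {v} 3≤deg =
    first-three (neighbours v) (neighbours-unique v) ∈-neighbours⁻ (subst (3 ≤_) (sym (length-neighbours v)) 3≤deg)
    where
    first-three : ∀ xs → Unique xs → (∀ {w} → w ∈ xs → Adj v w) → 3 ≤ length xs → ThreeNeighbours v
    first-three (_ ∷ []) _ _ (s≤s ())
    first-three (_ ∷ _ ∷ []) _ _ (s≤s (s≤s ()))
    first-three (x ∷ y ∷ w ∷ _) ((x≢y ∷ x≢w ∷ _) ∷ (y≢w ∷ _) ∷ _) adj _ =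
      (x , y , w) , (adj (here refl) , adj (there (here refl)) , adj (there (there (here refl)))) , (x≢y , y≢w , x≢w)

  star-at-deg3 : ∀ {v} → deg Γ v ≡ 3 → ∃ λ X → StarAt X v
  star-at-deg3 d3 with three-neighbours (≤-reflexive (sym d3))
  ... | _ , (vx , vy , vw) , (x≢y , y≢w , x≢w) =
    let (X , s) = star vx vy vw x≢y y≢w x≢w in X , star-at s (≤-reflexive d3)

  deg≤2-neighbour∈ : ∀ {v u} t → deg Γ v ≤ 2 → v ∈ᵗ t → Adj v u → u ∈ᵗ t
  deg≤2-neighbour∈ {v} t deg≤2 v∈t vu with TΓ.other-two t v∈t
  ... | x , y , (_ , (_ , x∈t , y∈t)) , v≢x , v≢y , x≢y
    with ∈-when-deg≤ ((x≢y ∷ []) ∷ [] ∷ []) (TΓ.∈ᵗ-adj t v∈t x∈t v≢x ∷ TΓ.∈ᵗ-adj t v∈t y∈t v≢y ∷ []) deg≤2 vu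
  ... | here refl = x∈t
  ... | there (here refl) = y∈t

  deg≤2-triangle-unique : ∀ {v} t t′ → deg Γ v ≤ 2 → v ∈ᵗ t → v ∈ᵗ t′ → t ≡ t′
  deg≤2-triangle-unique {v} t t′ deg≤2 v∈t v∈t′ = TΓ.triangle-ext t t′ (into t t′ v∈t v∈t′) (into t′ t v∈t′ v∈t)
    where
    into : ∀ s s′ → v ∈ᵗ s → v ∈ᵗ s′ → ∀ {u} → u ∈ᵗ s → u ∈ᵗ s′
    into s s′ v∈s v∈s′ {u} u∈s with u F.≟ v
    ... | yes refl = v∈s′
    ... | no u≢v = deg≤2-neighbour∈ s′ deg≤2 v∈s′ (TΓ.∈ᵗ-adj s v∈s u∈s (u≢v ∘ sym))

  star-≢ : ∀ {X X′ z ℓ ℓ′ u} → Star X z ℓ → Star X′ z ℓ′ → u ∈₃ ℓ → ¬ u ∈₃ ℓ′ → X ≢ X′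
  star-≢ {ℓ′ = ℓ′} s s′ u∈ℓ u∉ℓ′ refl =
    let (e , e∈X , e≐) = StarProperties.spoke s u∈ℓ
        (u′ , u′∈ℓ′ , e≐′) = Equivalence.to (Star.∈⇔spoke s′ e) e∈X
    in u∉ℓ′ (subst (_∈₃ ℓ′) (sym (≐₂-other-end {e} e≐ e≐′)) u′∈ℓ′)

  star-adj : ∀ {X X′ z ℓ ℓ′ u} → Star X z ℓ → Star X′ z ℓ′ → X ≢ X′ → u ∈₃ ℓ → u ∈₃ ℓ′ → TL.C₃Adj X X′
  star-adj {X} {X′} s s′ X≢X′ u∈ℓ u∈ℓ′ =
    let (e , e∈X , e≐) = StarProperties.spoke s u∈ℓ in
    Equivalence.from (TL.C₃Adj⇔ X X′) (X≢X′ , e , e∈X , Equivalence.from (Star.∈⇔spoke s′ e) (_ , u∈ℓ′ , e≐))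

  star-sides-adj : ∀ {X Y z ℓ t u} → Star X z ℓ → SidesOf Y t → u ∈₃ ℓ → z ∈ᵗ t → u ∈ᵗ t → TL.C₃Adj X Y
  star-sides-adj {X} {Y} s Y=t u∈ℓ z∈t u∈t =
    let (e , e∈X , e≐) = StarProperties.spoke s u∈ℓ in
    Equivalence.from (TL.C₃Adj⇔ X Y)
      ((λ { refl → star-not-sides s Y=t }) , e , e∈X , Equivalence.from (SidesOf.∈⇔⊆ Y=t e) (≐₂-within {e} e≐ z∈t u∈t))

  sides-≢ : ∀ {X X′ t t′ v} → SidesOf X t → SidesOf X′ t′ → v ∈ᵗ t′ → ¬ v ∈ᵗ t → X ≢ X′
  sides-≢ X=t X′=t′ v∈t′ v∉t refl with sides-unique X=t X′=t′
  ... | refl = v∉t v∈t′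

  star≢sides : ∀ {X Y z ℓ t} → Star X z ℓ → SidesOf Y t → X ≢ Y
  star≢sides s Y=t refl = star-not-sides s Y=t

  record SidesOn (x y z : Fin n) : Set where
    field
      X : Triangle (L Γ)
      t : Triangle (finO Γ)
      X=t : SidesOf X t
      t≐ : TΓ.vertices t ≐₃ (x , y , z)

    on : ∀ {v} → v ∈₃ (x , y , z) → v ∈ᵗ t
    on = ⊆₃-∈ (proj₂ t≐)

    off : ∀ {v} → ¬ v ∈₃ (x , y , z) → ¬ v ∈ᵗ t
    off v∉ = v∉ ∘ ⊆₃-∈ (proj₁ t≐)

  sides-on : ∀ {x y z} → Adj x y → Adj y z → Adj x z → SidesOn x y z
  sides-on xy yz xz =
    let (t , t≐) = TΓ.triangle xy yz xz ; (X , X=t) = sides-of t in record { X = X ; t = t ; X=t = X=t ; t≐ = t≐ }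

  star-at-adj⇔ : ∀ {X Y v w} → StarAt X v → StarAt Y w → TL.C₃Adj X Y ⇔ Adj v w
  star-at-adj⇔ {X} {Y} {v} {w} X=v Y=w = mk⇔ to from
    where
    through-v = λ {e} → Equivalence.to (StarAt.∈⇔∋ X=v e)
    through-w = λ {e} → Equivalence.to (StarAt.∈⇔∋ Y=w e)
    to : TL.C₃Adj X Y → Adj v w
    to XY with Equivalence.to (TL.C₃Adj⇔ X Y) XY
    ... | X≢Y , e , e∈X , e∈Y = ≐₂-adj {e} (≐₂-intro e (through-v e∈X) (through-w e∈Y) v≢w)
      where
      v≢w : v ≢ w
      v≢w refl = X≢Y (TL.triangle-⇔ X Y (StarAt.∈⇔∋ X=v) (StarAt.∈⇔∋ Y=w))
    from : Adj v w → TL.C₃Adj X Y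
    from vw = let (e , e≐) = edge-between vw in Equivalence.from (TL.C₃Adj⇔ X Y)
      ( (λ { refl → adj⇒≢ vw (common-vertex-unique {X} through-v through-w) })
      , e , Equivalence.from (StarAt.∈⇔∋ X=v e) (proj₁ (proj₂ e≐))
      , Equivalence.from (StarAt.∈⇔∋ Y=w e) (proj₂ (proj₂ e≐)))

  star-sides-adj⇔ : ∀ {X Y v t} → StarAt X v → SidesOf Y t → TL.C₃Adj X Y ⇔ v ∈ᵗ t
  star-sides-adj⇔ {X} {Y} {v} {t} X=v Y=t = mk⇔ to from
    where
    to : TL.C₃Adj X Y → v ∈ᵗ t
    to XY = let (_ , e , e∈X , e∈Y) = Equivalence.to (TL.C₃Adj⇔ X Y) XY in
      Equivalence.to (SidesOf.∈⇔⊆ Y=t e) e∈Y (Equivalence.to (StarAt.∈⇔∋ X=v e) e∈X)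
    from : v ∈ᵗ t → TL.C₃Adj X Y
    from v∈t =
      let (w , w∈t , v≢w) = TΓ.another-vertex t v∈t
          (e , e∈Y , e≐) = sides-edge Y=t v∈t w∈t v≢w
      in Equivalence.from (TL.C₃Adj⇔ X Y)
           ( (λ { refl → sides-no-centre Y=t (λ {e} → Equivalence.to (StarAt.∈⇔∋ X=v e)) })
           , e , Equivalence.from (StarAt.∈⇔∋ X=v e) (proj₁ (proj₂ e≐)) , e∈Y)

  ShareSide : Triangle (finO Γ) → Triangle (finO Γ) → Set
  ShareSide t t′ = ∃₂ λ x y → x ≢ y × (x ∈ᵗ t × y ∈ᵗ t) × (x ∈ᵗ t′ × y ∈ᵗ t′)

  sides-adj⇔ : ∀ {X Y t t′} → SidesOf X t → SidesOf Y t′ → TL.C₃Adj X Y ⇔ (t ≢ t′ × ShareSide t t′)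
  sides-adj⇔ {X} {Y} {t} {t′} X=t Y=t′ = mk⇔ to from
    where
    to : TL.C₃Adj X Y → t ≢ t′ × ShareSide t t′
    to XY with Equivalence.to (TL.C₃Adj⇔ X Y) XY
    ... | X≢Y , e , e∈X , e∈Y =
      (λ { refl → X≢Y (TL.triangle-⇔ X Y (SidesOf.∈⇔⊆ X=t) (SidesOf.∈⇔⊆ Y=t′)) }) ,
      Edge.u e , Edge.v e , ends-≢ e , (e⊆t end₁ , e⊆t end₂) , (e⊆t′ end₁ , e⊆t′ end₂)
      where
      e⊆t = Equivalence.to (SidesOf.∈⇔⊆ X=t e) e∈X
      e⊆t′ = Equivalence.to (SidesOf.∈⇔⊆ Y=t′ e) e∈Y
    from : t ≢ t′ × ShareSide t t′ → TL.C₃Adj X Y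
    from (t≢t′ , x , y , x≢y , (x∈t , y∈t) , (x∈t′ , y∈t′)) =
      let (e , e∈X , e≐) = sides-edge X=t x∈t y∈t x≢y in
      Equivalence.from (TL.C₃Adj⇔ X Y)
        ( (λ { refl → t≢t′ (sides-unique X=t Y=t′) })
        , e , e∈X , Equivalence.from (SidesOf.∈⇔⊆ Y=t′ e) (≐₂-within {e} e≐ x∈t′ y∈t′))

module FromConditions {n : ℕ} (Γ : FinGraph n)
  (deg∈23 : Cond1 Γ) (deg2-on-triangle : Cond2 Γ) (one-deg2-per-triangle : Cond3 Γ) (disjoint : Cond4 Γ) where
  open LineTriangles Γ

  private
    3≢2 : ∀ {v} → deg Γ v ≡ 3 → deg Γ v ≢ 2
    3≢2 d3 d2 with () ← trans (sym d3) d2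

  deg2-vertex : ∀ t → ∃ λ v → v ∈ᵗ t × deg Γ v ≡ 2 × (∀ {w} → w ∈ᵗ t → deg Γ w ≡ 2 → w ≡ v)
  deg2-vertex t =
    let (v , v∈t , d2 , unique) = exactly-one (λ x → deg Γ x ≡ᵇ 2) (one-deg2-per-triangle t)
    in v , v∈t , ≡ᵇ⇒≡ _ 2 d2 , λ w∈t d2′ → unique w∈t (≡⇒≡ᵇ _ 2 d2′)

  shared-vertex⇒≡ : ∀ t t′ {v} → v ∈ᵗ t → v ∈ᵗ t′ → t ≡ t′
  shared-vertex⇒≡ t t′ v∈t v∈t′ with t ≟ᵗ t′
  ... | yes t≡t′ = t≡t′
  ... | no t≢t′ = ⊥-elim (disjoint t t′ t≢t′ _ v∈t v∈t′)

  data Represents (v : Fin n) (X : Triangle (L Γ)) : Set where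
    centre : deg Γ v ≡ 3 → StarAt X v → Represents v X
    corner : ∀ {t} → deg Γ v ≡ 2 → v ∈ᵗ t → SidesOf X t → Represents v X

  represent : ∀ v → ∃ (Represents v)
  represent v with deg∈23 v
  ... | inj₁ d2 = let (t , v∈t) = deg2-on-triangle v d2 ; (X , X=t) = sides-of t in X , corner d2 v∈t X=t
  ... | inj₂ d3 = let (X , X=v) = star-at-deg3 d3 in X , centre d3 X=v

  representative : ∀ X → ∃ λ v → Represents v X
  representative X with classify X
  ... | inj₁ (z , _ , s) = z , centre d3 (star-at s (≤-reflexive d3))
    where
    d3 : deg Γ z ≡ 3
    d3 with deg∈23 z
    ... | inj₁ d2 with s≤s (s≤s ()) ← ≤-trans (StarProperties.3≤deg s) (≤-reflexive d2)
    ... | inj₂ d3 = d3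
  ... | inj₂ (t , X=t) = let (v , v∈t , d2 , _) = deg2-vertex t in v , corner d2 v∈t X=t

  represent-functional : ∀ {v X Y} → Represents v X → Represents v Y → X ≡ Y
  represent-functional (centre _ X=v) (centre _ Y=v) = TL.triangle-⇔ _ _ (StarAt.∈⇔∋ X=v) (StarAt.∈⇔∋ Y=v)
  represent-functional (centre d3 _) (corner d2 _ _) = ⊥-elim (3≢2 d3 d2)
  represent-functional (corner d2 _ _) (centre d3 _) = ⊥-elim (3≢2 d3 d2)
  represent-functional (corner {t} _ v∈t X=t) (corner {t′} _ v∈t′ Y=t′) with shared-vertex⇒≡ t t′ v∈t v∈t′
  ... | refl = TL.triangle-⇔ _ _ (SidesOf.∈⇔⊆ X=t) (SidesOf.∈⇔⊆ Y=t′)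

  represent-injective : ∀ {v w X} → Represents v X → Represents w X → v ≡ w
  represent-injective {X = X} (centre _ X=v) (centre _ X=w) =
    common-vertex-unique {X} (λ {e} → Equivalence.to (StarAt.∈⇔∋ X=v e)) (λ {e} → Equivalence.to (StarAt.∈⇔∋ X=w e))
  represent-injective (centre _ X=v) (corner _ _ X=t) =
    ⊥-elim (sides-no-centre X=t (λ {e} → Equivalence.to (StarAt.∈⇔∋ X=v e)))
  represent-injective (corner _ _ X=t) (centre _ X=w) =
    ⊥-elim (sides-no-centre X=t (λ {e} → Equivalence.to (StarAt.∈⇔∋ X=w e)))
  represent-injective (corner {t} d2 v∈t X=t) (corner d2′ w∈t′ X=t′) with sides-unique X=t X=t′
  ... | refl = let (_ , _ , _ , unique) = deg2-vertex t in trans (unique v∈t d2) (sym (unique w∈t′ d2′))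

  private
    star-corner-adj⇔ : ∀ {v w} t → deg Γ v ≡ 3 → deg Γ w ≡ 2 → w ∈ᵗ t → v ∈ᵗ t ⇔ Adj v w
    star-corner-adj⇔ t d3 d2 w∈t = mk⇔
      (λ v∈t → TΓ.∈ᵗ-adj t v∈t w∈t λ { refl → 3≢2 d3 d2 })
      (λ vw → deg≤2-neighbour∈ t (≤-reflexive d2) w∈t (adj-sym vw))

    -- Both sides fail: triangles sharing a vertex coincide, and its degree-2 vertex is unique.
    corners-not-adj : ∀ {v w} t t′ → deg Γ v ≡ 2 → deg Γ w ≡ 2 → v ∈ᵗ t → w ∈ᵗ t′ →
                      (t ≢ t′ × ShareSide t t′) ⇔ Adj v w
    corners-not-adj {v} {w} t t′ d2 d2′ v∈t w∈t′ = mk⇔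
      (λ (t≢t′ , (x , _ , _ , (x∈t , _) , (x∈t′ , _))) → ⊥-elim (t≢t′ (shared-vertex⇒≡ t t′ x∈t x∈t′)))
      (λ vw → ⊥-elim (adj⇒≢ vw (same-corner vw (shared-vertex⇒≡ t t′ (deg≤2-neighbour∈ t (≤-reflexive d2) v∈t vw) w∈t′))))
      where
      same-corner : Adj v w → t ≡ t′ → v ≡ w
      same-corner _ refl = let (_ , _ , _ , unique) = deg2-vertex t in trans (unique v∈t d2) (sym (unique w∈t′ d2′))

  represent-adj : ∀ {v w X Y} → Represents v X → Represents w Y → TL.C₃Adj X Y ⇔ Adj v w
  represent-adj (centre _ X=v) (centre _ Y=w) = star-at-adj⇔ X=v Y=w
  represent-adj (centre d3 X=v) (corner {t} d2 w∈t Y=t) = ⇔-trans (star-sides-adj⇔ X=v Y=t) (star-corner-adj⇔ t d3 d2 w∈t)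
  represent-adj {X = X} {Y} (corner {t} d2 v∈t X=t) (centre d3 Y=w) =
    ⇔-trans (mk⇔ (TL.C₃Adj-sym X Y) (TL.C₃Adj-sym Y X))
            (⇔-trans (star-sides-adj⇔ Y=w X=t) (⇔-trans (star-corner-adj⇔ t d3 d2 v∈t) (mk⇔ adj-sym adj-sym)))
  represent-adj (corner {t} d2 v∈t X=t) (corner {t′} d2′ w∈t′ Y=t′) =
    ⇔-trans (sides-adj⇔ X=t Y=t′) (corners-not-adj t t′ d2 d2′ v∈t w∈t′)

  isomorphism : C₃ (L Γ) ≅ finG Γ
  isomorphism = relation⇒≅ (C₃ (L Γ)) (finG Γ) (λ X v → Represents v X) representative represent
    represent-injective represent-functional
    (λ rv rw → T-injective (Equivalence.to (represent-adj rv rw)) (Equivalence.from (represent-adj rv rw)))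

module MaxDegree {n : ℕ} (Γ : FinGraph n) (iso : C₃ (L Γ) ≅ finG Γ) where
  open LineTriangles Γ
  open Cliques Γ

  φ : Triangle (L Γ) → Fin n
  φ = Inverse.to (proj₁ iso)

  ψ : Fin n → Triangle (L Γ)
  ψ = Inverse.from (proj₁ iso)

  φψ : ∀ x → φ (ψ x) ≡ x
  φψ x = Inverse.inverseˡ (proj₁ iso) refl

  ψφ : ∀ X → ψ (φ X) ≡ X
  ψφ X = Inverse.inverseʳ (proj₁ iso) refl

  φ-injective : ∀ {X Y} → φ X ≡ φ Y → X ≡ Y
  φ-injective {X} {Y} eq = trans (sym (ψφ X)) (trans (cong ψ eq) (ψφ Y))

  φ-adj : ∀ {X Y} → TL.C₃Adj X Y → Adj (φ X) (φ Y)
  φ-adj {X} {Y} = subst T (proj₂ iso X Y)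

  C₃-neighbours≤deg : ∀ {X Ys} → Unique Ys → All (TL.C₃Adj X) Ys → length Ys ≤ deg Γ (φ X)
  C₃-neighbours≤deg {X} {Ys} Ys! adj = subst (_≤ deg Γ (φ X)) (length-map φ Ys)
    (unique-neighbours≤deg (Unique.map⁺ φ-injective Ys!) (AllProperties.map⁺ (All.map φ-adj adj)))

  module _ {w x y} (wx : Adj w x) (wy : Adj w y) (x≢y : x ≢ y) where

    FanLeaf : Fin n → Set
    FanLeaf r = Adj w r × x ≢ r × y ≢ r

    fan : ∀ R → All FanLeaf R → List (Triangle (L Γ))
    fan [] [] = []
    fan (r ∷ R) ((wr , x≢r , y≢r) ∷ ok) = proj₁ (star wx wy wr x≢y y≢r x≢r) ∷ fan R ok

    length-fan : ∀ R ok → length (fan R ok) ≡ length R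
    length-fan [] [] = refl
    length-fan (r ∷ R) (_ ∷ ok) = cong suc (length-fan R ok)

    ∈-fan : ∀ {R ok X} → X ∈ fan R ok → ∃ λ r → r ∈ R × FanLeaf r × Star X w (x , y , r)
    ∈-fan {r ∷ R} {(wr , x≢r , y≢r) ∷ ok} (here refl) = r , here refl , (wr , x≢r , y≢r) , proj₂ (star wx wy wr x≢y y≢r x≢r)
    ∈-fan {r ∷ R} {_ ∷ ok} (there X∈) = let (r′ , r′∈R , rest) = ∈-fan X∈ in r′ , there r′∈R , rest

    fan-unique : ∀ {R} ok → Unique R → Unique (fan R ok)
    fan-unique [] [] = []
    fan-unique {r ∷ R} ((wr , x≢r , y≢r) ∷ ok) (r∉R ∷ R!) = All.tabulate distinct ∷ fan-unique ok R!
      where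
      distinct : ∀ {X} → X ∈ fan R ok → proj₁ (star wx wy wr x≢y y≢r x≢r) ≢ X
      distinct X∈ with ∈-fan X∈
      ... | r′ , r′∈R , _ , s′ = star-≢ (proj₂ (star wx wy wr x≢y y≢r x≢r)) s′ 3rd
                                   (∉₃ (x≢r ∘ sym) (y≢r ∘ sym) (All.lookup r∉R r′∈R))

  -- The star on a₁ a₂ a₃ at w shares a spoke with each of the stars on two of the aᵢ and a further neighbour r.
  module Fans {w a₁ a₂ a₃ R} (wa₁ : Adj w a₁) (wa₂ : Adj w a₂) (wa₃ : Adj w a₃) (wR : All (Adj w) R)
              (a₁≢a₂ : a₁ ≢ a₂) (a₂≢a₃ : a₂ ≢ a₃) (a₁≢a₃ : a₁ ≢ a₃)
              (a₁∉R : All (a₁ ≢_) R) (a₂∉R : All (a₂ ≢_) R) (a₃∉R : All (a₃ ≢_) R) (R! : Unique R) where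

    S = star wa₁ wa₂ wa₃ a₁≢a₂ a₂≢a₃ a₁≢a₃

    private
      r∉S : ∀ {r} → r ∈ R → ¬ r ∈₃ (a₁ , a₂ , a₃)
      r∉S r∈R = ∉₃ (All.lookup a₁∉R r∈R ∘ sym) (All.lookup a₂∉R r∈R ∘ sym) (All.lookup a₃∉R r∈R ∘ sym)

      leaves : ∀ {x y} → All (x ≢_) R → All (y ≢_) R → (wx : Adj w x) (wy : Adj w y) (x≢y : x ≢ y) →
               All (FanLeaf wx wy x≢y) R
      leaves x∉R y∉R _ _ _ = All.tabulate λ r∈R → All.lookup wR r∈R , All.lookup x∉R r∈R , All.lookup y∉R r∈R

      apart : ∀ {X ℓ ℓ′ u} → Star X w ℓ → Star X w ℓ′ → u ∈₃ ℓ → ¬ u ∈₃ ℓ′ → ⊥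
      apart s s′ u∈ℓ u∉ℓ′ = star-≢ s s′ u∈ℓ u∉ℓ′ refl

    fan₁₂ fan₁₃ fan₂₃ : List (Triangle (L Γ))
    fan₁₂ = fan wa₁ wa₂ a₁≢a₂ R (leaves a₁∉R a₂∉R wa₁ wa₂ a₁≢a₂)
    fan₁₃ = fan wa₁ wa₃ a₁≢a₃ R (leaves a₁∉R a₃∉R wa₁ wa₃ a₁≢a₃)
    fan₂₃ = fan wa₂ wa₃ a₂≢a₃ R (leaves a₂∉R a₃∉R wa₂ wa₃ a₂≢a₃)

    fan∼S : ∀ {x y} {wx : Adj w x} {wy : Adj w y} {x≢y : x ≢ y} {ok} → x ∈₃ (a₁ , a₂ , a₃) →
            All (TL.C₃Adj (proj₁ S)) (fan wx wy x≢y R ok)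
    fan∼S {wx = wx} {wy} {x≢y} x∈S = All.tabulate λ X∈ →
      let (r , r∈R , _ , s) = ∈-fan wx wy x≢y X∈ in
      star-adj (proj₂ S) s (λ S≡X → star-≢ s (proj₂ S) 3rd (r∉S r∈R) (sym S≡X)) x∈S 1st

    fans-unique : Unique (fan₁₂ ++ fan₁₃ ++ fan₂₃)
    fans-unique = Unique.++⁺ (fan-unique wa₁ wa₂ a₁≢a₂ _ R!)
      (Unique.++⁺ (fan-unique wa₁ wa₃ a₁≢a₃ _ R!) (fan-unique wa₂ wa₃ a₂≢a₃ _ R!) disjoint₁) disjoint₂
      where
      disjoint₁ : ∀ {X} → X ∈ fan₁₃ × X ∈ fan₂₃ → ⊥
      disjoint₁ (X∈₁₃ , X∈₂₃) with ∈-fan wa₁ wa₃ a₁≢a₃ X∈₁₃ | ∈-fan wa₂ wa₃ a₂≢a₃ X∈₂₃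
      ... | _ , _ , _ , s | r , r∈R , _ , s′ = apart s s′ 1st (∉₃ a₁≢a₂ a₁≢a₃ (All.lookup a₁∉R r∈R))
      disjoint₂ : ∀ {X} → X ∈ fan₁₂ × X ∈ fan₁₃ ++ fan₂₃ → ⊥
      disjoint₂ (X∈₁₂ , X∈rest) with ∈-fan wa₁ wa₂ a₁≢a₂ X∈₁₂ | ∈-++⁻ fan₁₃ X∈rest
      ... | _ , _ , _ , s | inj₁ X∈₁₃ = let (r , r∈R , _ , s′) = ∈-fan wa₁ wa₃ a₁≢a₃ X∈₁₃ in
                                          apart s s′ 2nd (∉₃ (a₁≢a₂ ∘ sym) a₂≢a₃ (All.lookup a₂∉R r∈R))
      ... | _ , _ , _ , s | inj₂ X∈₂₃ = let (r , r∈R , _ , s′) = ∈-fan wa₂ wa₃ a₂≢a₃ X∈₂₃ in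
                                          apart s s′ 1st (∉₃ a₁≢a₂ a₁≢a₃ (All.lookup a₁∉R r∈R))

    length-fans : length (fan₁₂ ++ fan₁₃ ++ fan₂₃) ≡ 3 * length R
    length-fans = begin
      length (fan₁₂ ++ fan₁₃ ++ fan₂₃)               ≡⟨ trans (length-++ fan₁₂) (cong (length fan₁₂ +_) (length-++ fan₁₃)) ⟩
      length fan₁₂ + (length fan₁₃ + length fan₂₃)    ≡⟨ cong₂ _+_ (length-fan wa₁ wa₂ a₁≢a₂ R _)
                                                           (cong₂ _+_ (length-fan wa₁ wa₃ a₁≢a₃ R _) (length-fan wa₂ wa₃ a₂≢a₃ R _)) ⟩
      length R + (length R + length R)                ≡⟨ cong (λ k → length R + (length R + k)) (sym (+-identityʳ _)) ⟩
      3 * length R                                    ∎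
      where open ≡-Reasoning

  fan-bound : ∀ {w a₁ a₂ a₃ R} → Unique (a₁ ∷ a₂ ∷ a₃ ∷ R) → All (Adj w) (a₁ ∷ a₂ ∷ a₃ ∷ R) →
              ∃ λ v → 3 * length R ≤ deg Γ v
  fan-bound ((a₁≢a₂ ∷ a₁≢a₃ ∷ a₁∉R) ∷ (a₂≢a₃ ∷ a₂∉R) ∷ a₃∉R ∷ R!) (wa₁ ∷ wa₂ ∷ wa₃ ∷ wR) =
    φ (proj₁ S) , subst (_≤ deg Γ (φ (proj₁ S))) length-fans
                        (C₃-neighbours≤deg fans-unique (AllProperties.++⁺ (fan∼S 1st) (AllProperties.++⁺ (fan∼S 1st) (fan∼S 2nd))))
    where open Fans wa₁ wa₂ wa₃ wR a₁≢a₂ a₂≢a₃ a₁≢a₃ a₁∉R a₂∉R a₃∉R R!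

  private
    3k≤3+k⇒k≤1 : ∀ k → 3 * k ≤ 3 + k → k ≤ 1
    3k≤3+k⇒k≤1 k 3k≤3+k with k ≤? 1
    ... | yes k≤1 = k≤1
    ... | no k≰1 = ⊥-elim (<-irrefl refl (≤-trans (4+k≤3k (≰⇒> k≰1)) 3k≤3+k))
      where
      4+k≤3k : 2 ≤ k → 4 + k ≤ 3 * k
      4+k≤3k 2≤k = subst (4 + k ≤_) (+-comm (2 * k) k) (+-monoˡ-≤ k (*-monoʳ-≤ 2 2≤k))

  max-degree≤4 : ∀ {w} → (∀ v → deg Γ v ≤ deg Γ w) → deg Γ w ≤ 4
  max-degree≤4 {w} maximal = subst (_≤ 4) (length-neighbours w)
    (bound (neighbours w) (neighbours-unique w) (All.tabulate ∈-neighbours⁻) (length-neighbours w))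
    where
    bound : ∀ N → Unique N → All (Adj w) N → length N ≡ deg Γ w → length N ≤ 4
    bound [] _ _ _ = z≤n
    bound (_ ∷ []) _ _ _ = s≤s z≤n
    bound (_ ∷ _ ∷ []) _ _ _ = s≤s (s≤s z≤n)
    bound (_ ∷ _ ∷ _ ∷ R) N! wN N≡deg = let (v , big) = fan-bound N! wN in
      s≤s (s≤s (s≤s (3k≤3+k⇒k≤1 (length R) (≤-trans big (≤-trans (maximal v) (≤-reflexive (sym N≡deg)))))))

  -- Around the star on b₁ b₂ b₃ there are two more stars at u and the three sides of the triangles of the K₄.
  deg4-off-K₄ : (∀ v → deg Γ v ≤ 4) → ∀ {u b₁ b₂ b₃} → deg Γ u ≡ 4 →
                Adj u b₁ → Adj u b₂ → Adj u b₃ → Adj b₁ b₂ → Adj b₁ b₃ → Adj b₂ b₃ → ⊥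
  deg4-off-K₄ max4 {u} {b₁} {b₂} {b₃} d4 ub₁ ub₂ ub₃ b₁b₂ b₁b₃ b₂b₃
    with outside-neighbour (b₁ ∷ b₂ ∷ b₃ ∷ []) (≤-reflexive (sym d4))
  ... | b₄ , ub₄ , b₄∉ = <-irrefl refl (≤-trans (C₃-neighbours≤deg Ns! Ns∼S) (max4 (φ (proj₁ S))))
    where
    b₁≢b₂ = adj⇒≢ b₁b₂
    b₁≢b₃ = adj⇒≢ b₁b₃
    b₂≢b₃ = adj⇒≢ b₂b₃
    b₄≢b₁ : b₄ ≢ b₁
    b₄≢b₁ = b₄∉ ∘ here
    b₄≢b₂ : b₄ ≢ b₂
    b₄≢b₂ = b₄∉ ∘ there ∘ here
    b₄≢b₃ : b₄ ≢ b₃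
    b₄≢b₃ = b₄∉ ∘ there ∘ there ∘ here
    S = star ub₁ ub₂ ub₃ b₁≢b₂ b₂≢b₃ b₁≢b₃
    N₁ = star ub₁ ub₂ ub₄ b₁≢b₂ (b₄≢b₂ ∘ sym) (b₄≢b₁ ∘ sym)
    N₂ = star ub₁ ub₃ ub₄ b₁≢b₃ (b₄≢b₃ ∘ sym) (b₄≢b₁ ∘ sym)
    T₁₂ = sides-on ub₁ b₁b₂ ub₂
    T₁₃ = sides-on ub₁ b₁b₃ ub₃
    T₂₃ = sides-on ub₂ b₂b₃ ub₃
    open SidesOn
    Ns = proj₁ N₁ ∷ proj₁ N₂ ∷ X T₁₂ ∷ X T₁₃ ∷ X T₂₃ ∷ []
    Ns∼S : All (TL.C₃Adj (proj₁ S)) Ns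
    Ns∼S = star-adj (proj₂ S) (proj₂ N₁) (star-≢ (proj₂ S) (proj₂ N₁) 3rd (∉₃ (b₁≢b₃ ∘ sym) (b₂≢b₃ ∘ sym) (b₄≢b₃ ∘ sym))) 1st 1st
         ∷ star-adj (proj₂ S) (proj₂ N₂) (star-≢ (proj₂ S) (proj₂ N₂) 2nd (∉₃ (b₁≢b₂ ∘ sym) b₂≢b₃ (b₄≢b₂ ∘ sym))) 1st 1st
         ∷ star-sides-adj (proj₂ S) (X=t T₁₂) 1st (on T₁₂ 1st) (on T₁₂ 2nd)
         ∷ star-sides-adj (proj₂ S) (X=t T₁₃) 1st (on T₁₃ 1st) (on T₁₃ 2nd)
         ∷ star-sides-adj (proj₂ S) (X=t T₂₃) 2nd (on T₂₃ 1st) (on T₂₃ 2nd)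
         ∷ []
    Ns! : Unique Ns
    Ns! = ( star-≢ (proj₂ N₁) (proj₂ N₂) 2nd (∉₃ (b₁≢b₂ ∘ sym) b₂≢b₃ (b₄≢b₂ ∘ sym))
          ∷ star≢sides (proj₂ N₁) (X=t T₁₂) ∷ star≢sides (proj₂ N₁) (X=t T₁₃) ∷ star≢sides (proj₂ N₁) (X=t T₂₃) ∷ [])
        ∷ (star≢sides (proj₂ N₂) (X=t T₁₂) ∷ star≢sides (proj₂ N₂) (X=t T₁₃) ∷ star≢sides (proj₂ N₂) (X=t T₂₃) ∷ [])
        ∷ ( sides-≢ (X=t T₁₂) (X=t T₁₃) (on T₁₃ 3rd) (off T₁₂ (∉₃ (adj⇒≢ ub₃ ∘ sym) (b₁≢b₃ ∘ sym) (b₂≢b₃ ∘ sym)))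
          ∷ sides-≢ (X=t T₁₂) (X=t T₂₃) (on T₂₃ 3rd) (off T₁₂ (∉₃ (adj⇒≢ ub₃ ∘ sym) (b₁≢b₃ ∘ sym) (b₂≢b₃ ∘ sym))) ∷ [])
        ∷ (sides-≢ (X=t T₁₃) (X=t T₂₃) (on T₂₃ 2nd) (off T₁₃ (∉₃ (adj⇒≢ ub₂ ∘ sym) (b₁≢b₂ ∘ sym) b₂≢b₃)) ∷ [])
        ∷ [] ∷ []

  K₄ : Fin n × Fin n × Fin n × Fin n → Set
  K₄ (y₁ , y₂ , y₃ , y₄) = AllPairs Adj (y₁ ∷ y₂ ∷ y₃ ∷ y₄ ∷ [])

  K₄-of-stars : ∀ {w} → deg Γ w ≡ 4 → ∃ K₄
  K₄-of-stars {w} d4 = spans (neighbours w) (neighbours-unique w) (All.tabulate ∈-neighbours⁻) (trans (length-neighbours w) d4)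
    where
    image-adj : ∀ {X X′ ℓ ℓ′ u v} → Star X w ℓ → Star X′ w ℓ′ → u ∈₃ ℓ → ¬ u ∈₃ ℓ′ → v ∈₃ ℓ → v ∈₃ ℓ′ → Adj (φ X) (φ X′)
    image-adj s s′ u∈ℓ u∉ℓ′ v∈ℓ v∈ℓ′ = φ-adj (star-adj s s′ (star-≢ s s′ u∈ℓ u∉ℓ′) v∈ℓ v∈ℓ′)
    spans : ∀ N → Unique N → All (Adj w) N → length N ≡ 4 → ∃ K₄
    spans (a₁ ∷ a₂ ∷ a₃ ∷ a₄ ∷ []) ((a₁≢a₂ ∷ a₁≢a₃ ∷ a₁≢a₄ ∷ []) ∷ (a₂≢a₃ ∷ a₂≢a₄ ∷ []) ∷ (a₃≢a₄ ∷ []) ∷ [] ∷ [])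
          (wa₁ ∷ wa₂ ∷ wa₃ ∷ wa₄ ∷ []) _ =
      (φ (proj₁ S₁) , φ (proj₁ S₂) , φ (proj₁ S₃) , φ (proj₁ S₄)) ,
      ( image-adj (proj₂ S₁) (proj₂ S₂) 1st (∉₃ (a₁≢a₂ ∘ sym) a₂≢a₃ a₂≢a₄) 2nd 2nd
      ∷ image-adj (proj₂ S₁) (proj₂ S₃) 2nd (∉₃ (a₁≢a₃ ∘ sym) (a₂≢a₃ ∘ sym) a₃≢a₄) 1st 2nd
      ∷ image-adj (proj₂ S₁) (proj₂ S₄) 3rd a₄∉S₄ 1st 2nd ∷ [])
      ∷ ( image-adj (proj₂ S₂) (proj₂ S₃) 2nd (∉₃ (a₁≢a₃ ∘ sym) (a₂≢a₃ ∘ sym) a₃≢a₄) 1st 1st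
        ∷ image-adj (proj₂ S₂) (proj₂ S₄) 3rd a₄∉S₄ 1st 1st ∷ [])
      ∷ (image-adj (proj₂ S₃) (proj₂ S₄) 3rd a₄∉S₄ 1st 1st ∷ [])
      ∷ [] ∷ []
      where
      S₁ = star wa₂ wa₃ wa₄ a₂≢a₃ a₃≢a₄ a₂≢a₄
      S₂ = star wa₁ wa₃ wa₄ a₁≢a₃ a₃≢a₄ a₁≢a₄
      S₃ = star wa₁ wa₂ wa₄ a₁≢a₂ a₂≢a₄ a₁≢a₄
      S₄ = star wa₁ wa₂ wa₃ a₁≢a₂ a₂≢a₃ a₁≢a₃
      a₄∉S₄ = ∉₃ (a₁≢a₄ ∘ sym) (a₂≢a₄ ∘ sym) (a₃≢a₄ ∘ sym)

  K₄-degree<4 : (∀ v → deg Γ v ≤ 4) → ∀ {y₁ y₂ y₃ y₄} → K₄ (y₁ , y₂ , y₃ , y₄) →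
                ∀ {u} → u ∈ y₁ ∷ y₂ ∷ y₃ ∷ y₄ ∷ [] → deg Γ u < 4
  K₄-degree<4 max4 ((y₁y₂ ∷ y₁y₃ ∷ y₁y₄ ∷ []) ∷ (y₂y₃ ∷ y₂y₄ ∷ []) ∷ (y₃y₄ ∷ []) ∷ [] ∷ []) {u} u∈Y
    with m≤n⇒m<n∨m≡n (max4 u)
  ... | inj₁ deg<4 = deg<4
  ... | inj₂ deg≡4 = ⊥-elim (off-K₄ u∈Y deg≡4)
    where
    off-K₄ : ∀ {u} → u ∈ _ → deg Γ u ≢ 4
    off-K₄ (here refl) d = deg4-off-K₄ max4 d y₁y₂ y₁y₃ y₁y₄ y₂y₃ y₂y₄ y₃y₄
    off-K₄ (there (here refl)) d = deg4-off-K₄ max4 d (adj-sym y₁y₂) y₂y₃ y₂y₄ y₁y₃ y₁y₄ y₃y₄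
    off-K₄ (there (there (here refl))) d = deg4-off-K₄ max4 d (adj-sym y₁y₃) (adj-sym y₂y₃) y₃y₄ y₁y₂ y₁y₄ y₂y₄
    off-K₄ (there (there (there (here refl)))) d = deg4-off-K₄ max4 d (adj-sym y₁y₄) (adj-sym y₂y₄) (adj-sym y₃y₄) y₁y₂ y₁y₃ y₂y₃

  -- Γ would be the K₄ spanned by the stars at a vertex of degree 4, whose vertices have degree 3.
  no-degree-4 : Connected Γ → (∀ v → deg Γ v ≤ 4) → ∀ w → deg Γ w ≢ 4
  no-degree-4 conn max4 w d4 = let (_ , Y∼) = K₄-of-stars d4 in
    <-irrefl d4 (K₄-degree<4 max4 Y∼ (connected-clique conn Y∼ (K₄-degree<4 max4 Y∼) w))

  private
    argmax : ∀ {m} (f : Fin m → ℕ) → Fin m → ∃ λ i → ∀ j → f j ≤ f i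
    argmax {suc zero} f _ = F.zero , λ { F.zero → ≤-refl }
    argmax {suc (suc m)} f _ with argmax (f ∘ F.suc) F.zero
    ... | i , max with f F.zero ≤? f (F.suc i)
    ... | yes f₀≤ = F.suc i , λ { F.zero → f₀≤ ; (F.suc j) → max j }
    ... | no f₀≰ = F.zero , λ { F.zero → ≤-refl ; (F.suc j) → ≤-trans (max j) (<⇒≤ (≰⇒> f₀≰)) }

  degree≤3 : Connected Γ → ∀ v → deg Γ v ≤ 3
  degree≤3 conn v with argmax (deg Γ) v
  ... | w , maximal with m≤n⇒m<n∨m≡n (max-degree≤4 maximal)
  ... | inj₁ deg<4 = ≤-trans (maximal v) (≤-pred deg<4)
  ... | inj₂ deg≡4 = ⊥-elim (no-degree-4 conn (λ u → ≤-trans (maximal u) (max-degree≤4 maximal)) w deg≡4)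

-- Vertices of C₃(L Γ) are coded by a centre of degree 3 or by the (sorted) corners of a triangle of Γ.
Code : ℕ → Set
Code n = Fin n ⊎ (Fin n × Fin n × Fin n)

module Codes {n : ℕ} (Γ : FinGraph n) where
  open LineTriangles Γ

  isTriangleᵇ : Fin n × Fin n × Fin n → Bool
  isTriangleᵇ (a , b , c) = (toℕ a <ᵇ toℕ b) ∧ (toℕ b <ᵇ toℕ c) ∧ edge? Γ a b ∧ edge? Γ b c ∧ edge? Γ a c

  valid : Code n → Bool
  valid (inj₁ v) = deg Γ v ≡ᵇ 3
  valid (inj₂ P) = isTriangleᵇ P

  _∈ᵇ_ : Fin n → Fin n × Fin n × Fin n → Bool
  v ∈ᵇ P = ∈₃ᵇ F._≟_ v P

  share-sideᵇ : Fin n × Fin n × Fin n → Fin n × Fin n × Fin n → Bool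
  share-sideᵇ (a , b , c) Q = (a ∈ᵇ Q ∧ b ∈ᵇ Q) ∨ (a ∈ᵇ Q ∧ c ∈ᵇ Q) ∨ (b ∈ᵇ Q ∧ c ∈ᵇ Q)

  _≟³_ : DecidableEquality (Fin n × Fin n × Fin n)
  _≟³_ = Product.≡-dec F._≟_ (Product.≡-dec F._≟_ F._≟_)

  adjᶜ : Code n → Code n → Bool
  adjᶜ (inj₁ v) (inj₁ w) = edge? Γ v w
  adjᶜ (inj₁ v) (inj₂ Q) = v ∈ᵇ Q
  adjᶜ (inj₂ P) (inj₁ w) = w ∈ᵇ P
  adjᶜ (inj₂ P) (inj₂ Q) = not ⌊ P ≟³ Q ⌋ ∧ share-sideᵇ P Q

  data Encodes : Code n → Triangle (L Γ) → Set where
    star-code : ∀ {v X} → deg Γ v ≡ 3 → StarAt X v → Encodes (inj₁ v) X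
    sides-code : ∀ {P X} t → TΓ.vertices t ≡ P → SidesOf X t → Encodes (inj₂ P) X

  encodes-valid : ∀ {k X} → Encodes k X → T (valid k)
  encodes-valid (star-code d3 _) = ≡⇒≡ᵇ _ 3 d3
  encodes-valid (sides-code (tri _ _ _ p) refl _) = recompute (T? _) p

  encode : (∀ v → deg Γ v ≤ 3) → ∀ X → ∃ λ k → Encodes k X
  encode deg≤3 X with classify X
  ... | inj₁ (z , _ , s) = let d3 = ≤-antisym (deg≤3 z) (StarProperties.3≤deg s) in
                           inj₁ z , star-code d3 (star-at s (deg≤3 z))
  ... | inj₂ (t , X=t) = inj₂ (TΓ.vertices t) , sides-code t refl X=t

  decode : ∀ k → T (valid k) → ∃ (Encodes k)
  decode (inj₁ v) d3 = let (X , X=v) = star-at-deg3 (≡ᵇ⇒≡ _ 3 d3) in X , star-code (≡ᵇ⇒≡ _ 3 d3) X=v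
  decode (inj₂ (a , b , c)) isTri = let (X , X=t) = sides-of (tri a b c isTri) in X , sides-code _ refl X=t

  encodes-functional : ∀ {k k′ X} → Encodes k X → Encodes k′ X → k ≡ k′
  encodes-functional {X = X} (star-code _ X=v) (star-code _ X=w) =
    cong inj₁ (common-vertex-unique {X} (λ {e} → Equivalence.to (StarAt.∈⇔∋ X=v e)) (λ {e} → Equivalence.to (StarAt.∈⇔∋ X=w e)))
  encodes-functional (star-code _ X=v) (sides-code _ _ X=t) =
    ⊥-elim (sides-no-centre X=t (λ {e} → Equivalence.to (StarAt.∈⇔∋ X=v e)))
  encodes-functional (sides-code _ _ X=t) (star-code _ X=v) =
    ⊥-elim (sides-no-centre X=t (λ {e} → Equivalence.to (StarAt.∈⇔∋ X=v e)))
  encodes-functional (sides-code t refl X=t) (sides-code t′ refl X=t′) = cong (inj₂ ∘ TΓ.vertices) (sides-unique X=t X=t′)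

  encodes-injective : ∀ {k X Y} → Encodes k X → Encodes k Y → X ≡ Y
  encodes-injective (star-code _ X=v) (star-code _ Y=v) = TL.triangle-⇔ _ _ (StarAt.∈⇔∋ X=v) (StarAt.∈⇔∋ Y=v)
  encodes-injective (sides-code t t≡ X=t) (sides-code t′ t′≡ Y=t′) with TΓ.vertices-injective t t′ (trans t≡ (sym t′≡))
  ... | refl = TL.triangle-⇔ _ _ (SidesOf.∈⇔⊆ X=t) (SidesOf.∈⇔⊆ Y=t′)

  ∈ᵇ⇔ : ∀ {v} P → T (v ∈ᵇ P) ⇔ v ∈₃ P
  ∈ᵇ⇔ = T-∈₃ᵇ F._≟_

  share-side⇔ : ∀ t t′ → ShareSide t t′ ⇔ T (share-sideᵇ (TΓ.vertices t) (TΓ.vertices t′))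
  share-side⇔ t@(tri a b c _) t′ = mk⇔ to from
    where
    Q = TΓ.vertices t′
    ∨₃ = T-∨₃ (a ∈ᵇ Q ∧ b ∈ᵇ Q) (a ∈ᵇ Q ∧ c ∈ᵇ Q) (b ∈ᵇ Q ∧ c ∈ᵇ Q)
    both : ∀ {x y} → x ∈ᵗ t′ → y ∈ᵗ t′ → T (x ∈ᵇ Q ∧ y ∈ᵇ Q)
    both {x} {y} x∈ y∈ = Equivalence.from (T-∧ {x ∈ᵇ Q}) (Equivalence.from (∈ᵇ⇔ Q) x∈ , Equivalence.from (∈ᵇ⇔ Q) y∈)
    split : ∀ {x y} → T (x ∈ᵇ Q ∧ y ∈ᵇ Q) → x ∈ᵗ t′ × y ∈ᵗ t′
    split {x} xy = let (x∈ , y∈) = Equivalence.to (T-∧ {x ∈ᵇ Q}) xy in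
      Equivalence.to (∈ᵇ⇔ Q) x∈ , Equivalence.to (∈ᵇ⇔ Q) y∈
    a≢b = TΓ.<ᵒ⇒≢ (TΓ.a<b t)
    a≢c = TΓ.<ᵒ⇒≢ (TΓ.a<c t)
    b≢c = TΓ.<ᵒ⇒≢ (TΓ.b<c t)
    to : ShareSide t t′ → T (share-sideᵇ (TΓ.vertices t) Q)
    to (x , y , x≢y , (x∈t , y∈t) , (x∈t′ , y∈t′)) with x∈t | y∈t
    ... | 1st | 1st = ⊥-elim (x≢y refl)
    ... | 2nd | 2nd = ⊥-elim (x≢y refl)
    ... | 3rd | 3rd = ⊥-elim (x≢y refl)
    ... | 1st | 2nd = Equivalence.from ∨₃ (inj₁ (both x∈t′ y∈t′))
    ... | 2nd | 1st = Equivalence.from ∨₃ (inj₁ (both y∈t′ x∈t′))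
    ... | 1st | 3rd = Equivalence.from ∨₃ (inj₂ (inj₁ (both x∈t′ y∈t′)))
    ... | 3rd | 1st = Equivalence.from ∨₃ (inj₂ (inj₁ (both y∈t′ x∈t′)))
    ... | 2nd | 3rd = Equivalence.from ∨₃ (inj₂ (inj₂ (both x∈t′ y∈t′)))
    ... | 3rd | 2nd = Equivalence.from ∨₃ (inj₂ (inj₂ (both y∈t′ x∈t′)))
    from : T (share-sideᵇ (TΓ.vertices t) Q) → ShareSide t t′
    from h with Equivalence.to ∨₃ h
    ... | inj₁ ab = a , b , a≢b , (1st , 2nd) , split ab
    ... | inj₂ (inj₁ ac) = a , c , a≢c , (1st , 3rd) , split ac
    ... | inj₂ (inj₂ bc) = b , c , b≢c , (2nd , 3rd) , split bc

  adjᶜ-sides : ∀ {t t′} → t ≢ t′ → ShareSide t t′ → T (adjᶜ (inj₂ (TΓ.vertices t)) (inj₂ (TΓ.vertices t′)))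
  adjᶜ-sides {t} {t′} t≢t′ share = Equivalence.from (T-∧ {not ⌊ TΓ.vertices t ≟³ TΓ.vertices t′ ⌋})
    (fromWitnessFalse (t≢t′ ∘ TΓ.vertices-injective t t′) , Equivalence.to (share-side⇔ t t′) share)

  encodes-adj : ∀ {k k′ X Y} → Encodes k X → Encodes k′ Y → TL.C₃Adj X Y ⇔ T (adjᶜ k k′)
  encodes-adj (star-code _ X=v) (star-code _ Y=w) = star-at-adj⇔ X=v Y=w
  encodes-adj (star-code _ X=v) (sides-code t refl Y=t) = ⇔-trans (star-sides-adj⇔ X=v Y=t) (⇔-sym (∈ᵇ⇔ _))
  encodes-adj {X = X} {Y} (sides-code t refl X=t) (star-code _ Y=w) =
    ⇔-trans (mk⇔ (TL.C₃Adj-sym X Y) (TL.C₃Adj-sym Y X)) (⇔-trans (star-sides-adj⇔ Y=w X=t) (⇔-sym (∈ᵇ⇔ _)))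
  encodes-adj (sides-code t refl X=t) (sides-code t′ refl Y=t′) = ⇔-trans (sides-adj⇔ X=t Y=t′) (mk⇔ to from)
    where
    P = TΓ.vertices t
    Q = TΓ.vertices t′
    to : t ≢ t′ × ShareSide t t′ → T (not ⌊ P ≟³ Q ⌋ ∧ share-sideᵇ P Q)
    to (t≢t′ , share) = adjᶜ-sides t≢t′ share
    from : T (not ⌊ P ≟³ Q ⌋ ∧ share-sideᵇ P Q) → t ≢ t′ × ShareSide t t′
    from h = let (P≢Q , share) = Equivalence.to (T-∧ {not ⌊ P ≟³ Q ⌋}) h in
      (λ { refl → toWitnessFalse P≢Q refl }) , Equivalence.from (share-side⇔ t t′) share

module CodeSums (n : ℕ) where

  ∑³ : (Fin n → Fin n → Fin n → ℕ) → ℕ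
  ∑³ f = ∑[ a < n ] ∑[ b < n ] ∑[ c < n ] f a b c

  ∑ᶜ : (Code n → ℕ) → ℕ
  ∑ᶜ h = ∑[ v < n ] h (inj₁ v) + ∑³ (λ a b c → h (inj₂ (a , b , c)))

  module _ {f g : Fin n → Fin n → Fin n → ℕ} where

    ∑³-cong : (∀ a b c → f a b c ≡ g a b c) → ∑³ f ≡ ∑³ g
    ∑³-cong f≗g = sum-cong-≗ λ a → sum-cong-≗ λ b → sum-cong-≗ λ c → f≗g a b c

    ∑³-distrib-+ : ∑³ (λ a b c → f a b c + g a b c) ≡ ∑³ f + ∑³ g
    ∑³-distrib-+ = trans (sum-cong-≗ λ a → trans (sum-cong-≗ λ b → ∑-distrib-+ (f a b) (g a b))
                                                 (∑-distrib-+ (λ b → sum (f a b)) (λ b → sum (g a b))))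
                         (∑-distrib-+ (λ a → ∑[ b < n ] sum (f a b)) (λ a → ∑[ b < n ] sum (g a b)))

    ∑³-mono-≤ : (∀ a b c → f a b c ≤ g a b c) → ∑³ f ≤ ∑³ g
    ∑³-mono-≤ f≤g = ∑-mono-≤ λ a → ∑-mono-≤ λ b → ∑-mono-≤ λ c → f≤g a b c

    ∑³-≤-pointwise-≡ : (∀ a b c → f a b c ≤ g a b c) → ∑³ f ≡ ∑³ g → ∀ a b c → f a b c ≡ g a b c
    ∑³-≤-pointwise-≡ f≤g eq a b c =
      ∑-≤-pointwise-≡ (f≤g a b) (∑-≤-pointwise-≡ (λ b → ∑-mono-≤ (f≤g a b))
        (∑-≤-pointwise-≡ (λ a → ∑-mono-≤ λ b → ∑-mono-≤ (f≤g a b)) eq a) b) c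

  *-distribˡ-∑³ : ∀ m (f : Fin n → Fin n → Fin n → ℕ) → m * ∑³ f ≡ ∑³ (λ a b c → m * f a b c)
  *-distribˡ-∑³ m f = trans (*-distribˡ-sum m λ a → ∑[ b < n ] ∑[ c < n ] f a b c) (sum-cong-≗ λ a →
    trans (*-distribˡ-sum m λ b → ∑[ c < n ] f a b c) (sum-cong-≗ λ b → *-distribˡ-sum m (f a b)))

  ∑³-zero : ∀ {f : Fin n → Fin n → Fin n → ℕ} → (∀ a b c → f a b c ≡ 0) → ∑³ f ≡ 0
  ∑³-zero f≗0 = ∑-zero λ a → ∑-zero λ b → ∑-zero λ c → f≗0 a b c

  term≤∑³ : ∀ (f : Fin n → Fin n → Fin n → ℕ) a b c → f a b c ≤ ∑³ f
  term≤∑³ f a b c = ≤-trans (term≤∑ (f a b) c) (≤-trans (term≤∑ (λ b → sum (f a b)) b) (term≤∑ _ a))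

  ∑³-positive : ∀ (f : Fin n → Fin n → Fin n → ℕ) → 0 < ∑³ f → ∃ λ ((a , b , c) : Fin n × Fin n × Fin n) → 0 < f a b c
  ∑³-positive f pos =
    let (a , pa) = ∑-positive _ pos ; (b , pb) = ∑-positive _ pa ; (c , pc) = ∑-positive _ pb in (a , b , c) , pc

  ∑-∑³-comm : ∀ (f : Fin n → Fin n → Fin n → Fin n → ℕ) →
              ∑[ x < n ] ∑³ (f x) ≡ ∑³ (λ a b c → ∑[ x < n ] f x a b c)
  ∑-∑³-comm f = trans (∑-comm λ x a → ∑[ b < n ] ∑[ c < n ] f x a b c) (sum-cong-≗ λ a →
    trans (∑-comm λ x b → ∑[ c < n ] f x a b c) (sum-cong-≗ λ b → ∑-comm λ x c → f x a b c))

  ∑ᶜ-cong : ∀ {g h : Code n → ℕ} → (∀ k → g k ≡ h k) → ∑ᶜ g ≡ ∑ᶜ h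
  ∑ᶜ-cong g≗h = cong₂ _+_ (sum-cong-≗ (g≗h ∘ inj₁)) (∑³-cong λ a b c → g≗h (inj₂ (a , b , c)))

  ∑-∑ᶜ-comm : ∀ (f : Fin n → Code n → ℕ) → ∑[ x < n ] ∑ᶜ (f x) ≡ ∑ᶜ (λ k → ∑[ x < n ] f x k)
  ∑-∑ᶜ-comm f = trans (∑-distrib-+ (λ x → ∑[ v < n ] f x (inj₁ v)) (λ x → ∑³ λ a b c → f x (inj₂ (a , b , c))))
    (cong₂ _+_ (∑-comm λ x v → f x (inj₁ v)) (∑-∑³-comm λ x a b c → f x (inj₂ (a , b , c))))

  δᶜ : Code n → Code n → ℕ → ℕ
  δᶜ (inj₁ v₀) (inj₁ v) m = if ⌊ v F.≟ v₀ ⌋ then m else 0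
  δᶜ (inj₂ (a₀ , b₀ , c₀)) (inj₂ (a , b , c)) m =
    if ⌊ a F.≟ a₀ ⌋ then (if ⌊ b F.≟ b₀ ⌋ then (if ⌊ c F.≟ c₀ ⌋ then m else 0) else 0) else 0
  δᶜ (inj₁ _) (inj₂ _) _ = 0
  δᶜ (inj₂ _) (inj₁ _) _ = 0

  private
    ∑-if : ∀ p (f : Fin n → ℕ) → ∑[ i < n ] (if p then f i else 0) ≡ (if p then sum f else 0)
    ∑-if true f = refl
    ∑-if false f = ∑-zero {n} λ _ → refl

    if-* : ∀ p m → (if p then m else 0) ≡ (if p then 1 else 0) * m
    if-* true m = sym (+-identityʳ m)
    if-* false m = refl

  ∑³-δᶜ : ∀ a₀ b₀ c₀ (g : Fin n → Fin n → Fin n → ℕ) →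
          ∑³ (λ a b c → δᶜ (inj₂ (a₀ , b₀ , c₀)) (inj₂ (a , b , c)) (g a b c)) ≡ g a₀ b₀ c₀
  ∑³-δᶜ a₀ b₀ c₀ g = begin
    ∑³ (λ a b c → if ⌊ a F.≟ a₀ ⌋ then inner a b c else 0)
      ≡⟨ sum-cong-≗ (λ a → trans (sum-cong-≗ λ b → ∑-if ⌊ a F.≟ a₀ ⌋ (inner a b))
                                 (∑-if ⌊ a F.≟ a₀ ⌋ λ b → sum (inner a b))) ⟩
    ∑[ a < n ] (if ⌊ a F.≟ a₀ ⌋ then ∑[ b < n ] sum (inner a b) else 0)
      ≡⟨ ∑-δ a₀ (λ a → ∑[ b < n ] sum (inner a b)) ⟩
    ∑[ b < n ] ∑[ c < n ] inner a₀ b c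
      ≡⟨ trans (sum-cong-≗ λ b → ∑-if ⌊ b F.≟ b₀ ⌋ (innermost b)) (∑-δ b₀ λ b → sum (innermost b)) ⟩
    ∑[ c < n ] innermost b₀ c
      ≡⟨ ∑-δ c₀ (g a₀ b₀) ⟩
    g a₀ b₀ c₀ ∎
    where
    open ≡-Reasoning
    innermost : Fin n → Fin n → ℕ
    innermost b c = if ⌊ c F.≟ c₀ ⌋ then g a₀ b c else 0
    inner : Fin n → Fin n → Fin n → ℕ
    inner a b c = if ⌊ b F.≟ b₀ ⌋ then (if ⌊ c F.≟ c₀ ⌋ then g a b c else 0) else 0

  ∑ᶜ-δᶜ : ∀ k₀ (g : Code n → ℕ) → ∑ᶜ (λ k → δᶜ k₀ k (g k)) ≡ g k₀
  ∑ᶜ-δᶜ (inj₁ v₀) g = trans (cong₂ _+_ (∑-δ v₀ (g ∘ inj₁)) (∑³-zero λ _ _ _ → refl)) (+-identityʳ _)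
  ∑ᶜ-δᶜ (inj₂ (a₀ , b₀ , c₀)) g =
    trans (cong₂ _+_ (∑-zero {n} λ _ → refl) refl) (∑³-δᶜ a₀ b₀ c₀ λ a b c → g (inj₂ (a , b , c)))

  δᶜ-diag : ∀ k m → δᶜ k k m ≡ m
  δᶜ-diag (inj₁ v) m with v F.≟ v
  ... | yes _ = refl
  ... | no v≢v = ⊥-elim (v≢v refl)
  δᶜ-diag (inj₂ (a , b , c)) m with a F.≟ a | b F.≟ b | c F.≟ c
  ... | yes _ | yes _ | yes _ = refl
  ... | no a≢a | _ | _ = ⊥-elim (a≢a refl)
  ... | yes _ | no b≢b | _ = ⊥-elim (b≢b refl)
  ... | yes _ | yes _ | no c≢c = ⊥-elim (c≢c refl)

  δᶜ-≢ : ∀ k₀ k m → k ≢ k₀ → δᶜ k₀ k m ≡ 0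
  δᶜ-≢ (inj₁ v₀) (inj₁ v) m k≢k₀ with v F.≟ v₀
  ... | yes refl = ⊥-elim (k≢k₀ refl)
  ... | no _ = refl
  δᶜ-≢ (inj₂ (a₀ , b₀ , c₀)) (inj₂ (a , b , c)) m k≢k₀ with a F.≟ a₀ | b F.≟ b₀ | c F.≟ c₀
  ... | yes refl | yes refl | yes refl = ⊥-elim (k≢k₀ refl)
  ... | no _ | _ | _ = refl
  ... | yes _ | no _ | _ = refl
  ... | yes _ | yes _ | no _ = refl
  δᶜ-≢ (inj₁ _) (inj₂ _) _ _ = refl
  δᶜ-≢ (inj₂ _) (inj₁ _) _ _ = refl

  δᶜ-* : ∀ k₀ k m → δᶜ k₀ k m ≡ δᶜ k₀ k 1 * m
  δᶜ-* (inj₁ v₀) (inj₁ v) m = if-* ⌊ v F.≟ v₀ ⌋ m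
  δᶜ-* (inj₂ (a₀ , b₀ , c₀)) (inj₂ (a , b , c)) m with a F.≟ a₀ | b F.≟ b₀
  ... | yes _ | yes _ = if-* ⌊ c F.≟ c₀ ⌋ m
  ... | yes _ | no _ = refl
  ... | no _ | _ = refl
  δᶜ-* (inj₁ _) (inj₂ _) _ = refl
  δᶜ-* (inj₂ _) (inj₁ _) _ = refl

  module Reindex (valid : Code n → Bool) (c : Fin n → Code n) (c-injective : ∀ {x y} → c x ≡ c y → x ≡ y)
                 (c-valid : ∀ x → T (valid (c x))) (c-onto : ∀ k → T (valid k) → ∃ λ x → c x ≡ k) where

    fibre : ∀ k → ∑[ x < n ] δᶜ (c x) k 1 ≡ 𝟙 (valid k)
    fibre k with valid k in valid-k
    ... | true = let (x₀ , cx₀≡k) = c-onto k (subst T (sym valid-k) tt) in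
      trans (sum-cong-≗ (hit x₀ cx₀≡k)) (∑-δ x₀ λ _ → 1)
      where
      hit : ∀ x₀ → c x₀ ≡ k → ∀ x → δᶜ (c x) k 1 ≡ (if ⌊ x F.≟ x₀ ⌋ then 1 else 0)
      hit x₀ refl x with x F.≟ x₀
      ... | yes refl = δᶜ-diag (c x) 1
      ... | no x≢x₀ = δᶜ-≢ (c x) (c x₀) 1 (x≢x₀ ∘ sym ∘ c-injective)
    ... | false = ∑-zero λ x → δᶜ-≢ (c x) k 1 λ { refl → subst T valid-k (c-valid x) }

    reindex : ∀ h → ∑[ x < n ] h (c x) ≡ ∑ᶜ (λ k → 𝟙 (valid k) * h k)
    reindex h = begin
      ∑[ x < n ] h (c x)                             ≡⟨ sum-cong-≗ (λ x → sym (∑ᶜ-δᶜ (c x) h)) ⟩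
      ∑[ x < n ] ∑ᶜ (λ k → δᶜ (c x) k (h k))         ≡⟨ ∑-∑ᶜ-comm (λ x k → δᶜ (c x) k (h k)) ⟩
      ∑ᶜ (λ k → ∑[ x < n ] δᶜ (c x) k (h k))         ≡⟨ ∑ᶜ-cong pull-out ⟩
      ∑ᶜ (λ k → 𝟙 (valid k) * h k)                   ∎
      where
      open ≡-Reasoning
      pull-out : ∀ k → ∑[ x < n ] δᶜ (c x) k (h k) ≡ 𝟙 (valid k) * h k
      pull-out k = trans (sum-cong-≗ λ x → δᶜ-* (c x) k (h k))
        (trans (sym (*-distribʳ-sum (h k) λ x → δᶜ (c x) k 1)) (cong (_* h k) (fibre k)))

module TriangleCounts {n : ℕ} (Γ : FinGraph n) where
  open LineTriangles Γ
  open Codes Γ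

  triangle-corners-≢ : ∀ {a b c} → T (isTriangleᵇ (a , b , c)) → a ≢ b × a ≢ c × b ≢ c
  triangle-corners-≢ {a} {b} {c} isTri = let t = tri a b c isTri in
    TΓ.<ᵒ⇒≢ (TΓ.a<b t) , TΓ.<ᵒ⇒≢ (TΓ.a<c t) , TΓ.<ᵒ⇒≢ (TΓ.b<c t)

  corner-sum : ∀ {a b c} → T (isTriangleᵇ (a , b , c)) → ∀ (h : Fin n → ℕ) →
               ∑[ v < n ] (h v * 𝟙 (v ∈ᵇ (a , b , c))) ≡ h a + h b + h c
  corner-sum {a} {b} {c} isTri h = begin
    ∑[ v < n ] (h v * 𝟙 (v ∈ᵇ (a , b , c)))  ≡⟨ sum-cong-≗ split ⟩
    ∑[ v < n ] (at a v + at b v + at c v)   ≡⟨ trans (∑-distrib-+ (λ v → at a v + at b v) (at c))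
                                                     (cong (_+ sum (at c)) (∑-distrib-+ (at a) (at b))) ⟩
    sum (at a) + sum (at b) + sum (at c)    ≡⟨ cong₂ _+_ (cong₂ _+_ (∑-δ a h) (∑-δ b h)) (∑-δ c h) ⟩
    h a + h b + h c                          ∎
    where
    open ≡-Reasoning
    at : Fin n → Fin n → ℕ
    at x v = if ⌊ v F.≟ x ⌋ then h v else 0
    distinct = triangle-corners-≢ {a} {b} {c} isTri
    split : ∀ v → h v * 𝟙 (v ∈ᵇ (a , b , c)) ≡ at a v + at b v + at c v
    split v with v F.≟ a | v F.≟ b | v F.≟ c
    ... | yes refl | yes refl | _ = ⊥-elim (proj₁ distinct refl)
    ... | yes refl | no _ | yes refl = ⊥-elim (proj₁ (proj₂ distinct) refl)
    ... | no _ | yes refl | yes refl = ⊥-elim (proj₂ (proj₂ distinct) refl)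
    ... | yes _ | no _ | no _ = trans (*-identityʳ (h v)) (sym (trans (+-identityʳ _) (+-identityʳ _)))
    ... | no _ | yes _ | no _ = trans (*-identityʳ (h v)) (sym (+-identityʳ _))
    ... | no _ | no _ | yes _ = *-identityʳ (h v)
    ... | no _ | no _ | no _ = *-zeroʳ (h v)

module FromIsomorphism {n : ℕ} (Γ : FinGraph n) (conn : Connected Γ) (iso : C₃ (L Γ) ≅ finG Γ) where
  open LineTriangles Γ
  open MaxDegree Γ iso
  open Codes Γ
  open CodeSums n

  code : Triangle (L Γ) → Code n
  code X = proj₁ (encode (degree≤3 conn) X)

  code-encodes : ∀ X → Encodes (code X) X
  code-encodes X = proj₂ (encode (degree≤3 conn) X)

  private
    c-injective : ∀ {x y} → code (ψ x) ≡ code (ψ y) → x ≡ y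
    c-injective {x} {y} eq = trans (sym (φψ x)) (trans (cong φ ψx≡ψy) (φψ y))
      where
      ψx≡ψy : ψ x ≡ ψ y
      ψx≡ψy = encodes-injective (code-encodes (ψ x)) (subst (λ k → Encodes k (ψ y)) (sym eq) (code-encodes (ψ y)))

    c-onto : ∀ k → T (valid k) → ∃ λ x → code (ψ x) ≡ k
    c-onto k valid-k = let (X , X-enc) = decode k valid-k in
      φ X , trans (cong code (ψφ X)) (encodes-functional (code-encodes X) X-enc)

  open Reindex valid (code ∘ ψ) c-injective (λ x → encodes-valid (code-encodes (ψ x))) c-onto

  edge≡adjᶜ : ∀ x y → edge? Γ x y ≡ adjᶜ (code (ψ x)) (code (ψ y))
  edge≡adjᶜ x y = begin
    edge? Γ x y                                 ≡⟨ cong₂ (edge? Γ) (sym (φψ x)) (sym (φψ y)) ⟩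
    edge? Γ (φ (ψ x)) (φ (ψ y))                 ≡⟨ sym (proj₂ iso (ψ x) (ψ y)) ⟩
    Graph.adj (C₃ (L Γ)) (ψ x) (ψ y)            ≡⟨ T-injective (Equivalence.to adj⇔) (Equivalence.from adj⇔) ⟩
    adjᶜ (code (ψ x)) (code (ψ y))              ∎
    where
    open ≡-Reasoning
    adj⇔ = encodes-adj (code-encodes (ψ x)) (code-encodes (ψ y))

  open TriangleCounts Γ

  high low : Fin n → ℕ
  high v = 𝟙 (deg Γ v ≡ᵇ 3)
  low v = 𝟙 (not (deg Γ v ≡ᵇ 3))

  high+low≡1 : ∀ v → high v + low v ≡ 1
  high+low≡1 v with deg Γ v ≡ᵇ 3
  ... | true = refl
  ... | false = refl

  τ : Fin n → Fin n → Fin n → ℕ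
  τ a b c = 𝟙 (isTriangleᵇ (a , b , c))

  corner : Fin n → Fin n → Fin n → Fin n → ℕ
  corner v a b c = 𝟙 (v ∈ᵇ (a , b , c))

  triangles-at high-neighbours low-neighbours : Fin n → ℕ
  triangles-at v = ∑³ λ a b c → τ a b c * corner v a b c
  high-neighbours u = ∑[ v < n ] (high v * 𝟙 (edge? Γ u v))
  low-neighbours u = ∑[ v < n ] (low v * 𝟙 (edge? Γ u v))

  high-corners side-neighbours : Fin n → Fin n → Fin n → ℕ
  high-corners a b c = ∑[ v < n ] (high v * corner v a b c)
  side-neighbours a b c = ∑³ λ a′ b′ c′ → τ a′ b′ c′ * 𝟙 (adjᶜ (inj₂ (a , b , c)) (inj₂ (a′ , b′ , c′)))

  #triangles side-pairs : ℕ
  #triangles = ∑³ τ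
  side-pairs = ∑³ λ a b c → τ a b c * side-neighbours a b c

  #high+#triangles≡n : sum high + #triangles ≡ n
  #high+#triangles≡n = begin
    sum high + #triangles
      ≡⟨ sym (cong₂ _+_ (sum-cong-≗ λ v → *-identityʳ (high v)) (∑³-cong λ a b c → *-identityʳ (τ a b c))) ⟩
    ∑ᶜ (λ k → 𝟙 (valid k) * 1)          ≡⟨ sym (reindex λ _ → 1) ⟩
    ∑[ x < n ] 1                          ≡⟨ trans (∑-const n 1) (*-identityʳ n) ⟩
    n                                     ∎
    where open ≡-Reasoning

  #low≡#triangles : sum low ≡ #triangles
  #low≡#triangles = +-cancelˡ-≡ (sum high) _ _ (begin
    sum high + sum low               ≡⟨ sym (∑-distrib-+ high low) ⟩
    ∑[ v < n ] (high v + low v)      ≡⟨ sum-cong-≗ high+low≡1 ⟩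
    ∑[ v < n ] 1                      ≡⟨ trans (∑-const n 1) (*-identityʳ n) ⟩
    n                                 ≡⟨ sym #high+#triangles≡n ⟩
    sum high + #triangles            ∎)
    where open ≡-Reasoning

  -- The degree of a vertex of Γ is the degree of the corresponding vertex of C₃(L Γ).
  degree-sum : ∑[ x < n ] deg Γ x ≡ ∑[ v < n ] (high v * (high-neighbours v + triangles-at v))
                                  + ∑³ (λ a b c → τ a b c * (high-corners a b c + side-neighbours a b c))
  degree-sum = begin
    ∑[ x < n ] deg Γ x
      ≡⟨ sum-cong-≗ (λ x → trans (deg≡∑ x) (sum-cong-≗ λ y → cong 𝟙 (edge≡adjᶜ x y))) ⟩
    ∑[ x < n ] ∑[ y < n ] 𝟙 (adjᶜ (code (ψ x)) (code (ψ y)))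
      ≡⟨ sum-cong-≗ (λ x → reindex λ k → 𝟙 (adjᶜ (code (ψ x)) k)) ⟩
    ∑[ x < n ] ∑ᶜ (λ k → 𝟙 (valid k) * 𝟙 (adjᶜ (code (ψ x)) k))
      ≡⟨ reindex (λ k₀ → ∑ᶜ λ k → 𝟙 (valid k) * 𝟙 (adjᶜ k₀ k)) ⟩
    ∑ᶜ (λ k₀ → 𝟙 (valid k₀) * ∑ᶜ (λ k → 𝟙 (valid k) * 𝟙 (adjᶜ k₀ k))) ∎
    where open ≡-Reasoning

  private
    exchange : ∀ x y z → x * (y * z) ≡ y * (x * z)
    exchange = x∙yz≈y∙xz

  weighted-corner-count : ∀ (h : Fin n → ℕ) →
    ∑³ (λ a b c → τ a b c * ∑[ v < n ] (h v * corner v a b c)) ≡ ∑[ v < n ] (h v * triangles-at v)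
  weighted-corner-count h = begin
    ∑³ (λ a b c → τ a b c * ∑[ v < n ] (h v * corner v a b c))
      ≡⟨ ∑³-cong (λ a b c → *-distribˡ-sum (τ a b c) λ v → h v * corner v a b c) ⟩
    ∑³ (λ a b c → ∑[ v < n ] (τ a b c * (h v * corner v a b c)))
      ≡⟨ sym (∑-∑³-comm λ v a b c → τ a b c * (h v * corner v a b c)) ⟩
    ∑[ v < n ] ∑³ (λ a b c → τ a b c * (h v * corner v a b c))
      ≡⟨ sum-cong-≗ (λ v → trans (∑³-cong λ a b c → exchange (τ a b c) (h v) (corner v a b c))
                                 (sym (*-distribˡ-∑³ (h v) λ a b c → τ a b c * corner v a b c))) ⟩
    ∑[ v < n ] (h v * triangles-at v) ∎
    where open ≡-Reasoning

  split-by-degree : ∀ (f : Fin n → ℕ) → sum f ≡ ∑[ v < n ] (high v * f v) + ∑[ v < n ] (low v * f v)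
  split-by-degree f = trans (sum-cong-≗ split) (∑-distrib-+ (λ v → high v * f v) (λ v → low v * f v))
    where
    split : ∀ v → f v ≡ high v * f v + low v * f v
    split v = trans (sym (*-identityˡ (f v)))
                    (trans (cong (_* f v) (sym (high+low≡1 v))) (*-distribʳ-+ (f v) (high v) (low v)))

  degree-split : ∀ x → deg Γ x ≡ high-neighbours x + low-neighbours x
  degree-split x = trans (deg≡∑ x) (split-by-degree λ v → 𝟙 (edge? Γ x v))

  high-low-exchange : ∑[ x < n ] (high x * low-neighbours x) ≡ ∑[ u < n ] (low u * high-neighbours u)
  high-low-exchange = begin
    ∑[ x < n ] (high x * low-neighbours x)
      ≡⟨ sum-cong-≗ (λ x → *-distribˡ-sum (high x) λ v → low v * 𝟙 (edge? Γ x v)) ⟩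
    ∑[ x < n ] ∑[ v < n ] (high x * (low v * 𝟙 (edge? Γ x v)))
      ≡⟨ ∑-comm (λ x v → high x * (low v * 𝟙 (edge? Γ x v))) ⟩
    ∑[ v < n ] ∑[ x < n ] (high x * (low v * 𝟙 (edge? Γ x v)))
      ≡⟨ sum-cong-≗ (λ v → sum-cong-≗ λ x → trans (exchange (high x) (low v) _)
                                                  (cong (λ e → low v * (high x * 𝟙 e)) (FinGraph.sym Γ x v))) ⟩
    ∑[ v < n ] ∑[ x < n ] (low v * (high x * 𝟙 (edge? Γ v x)))
      ≡⟨ sum-cong-≗ (λ v → sym (*-distribˡ-sum (low v) λ x → high x * 𝟙 (edge? Γ v x))) ⟩
    ∑[ u < n ] (low u * high-neighbours u) ∎
    where open ≡-Reasoning

  corner-count : ∑[ v < n ] triangles-at v ≡ 3 * #triangles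
  corner-count = begin
    ∑[ v < n ] triangles-at v
      ≡⟨ ∑-∑³-comm (λ v a b c → τ a b c * corner v a b c) ⟩
    ∑³ (λ a b c → ∑[ v < n ] (τ a b c * corner v a b c))
      ≡⟨ ∑³-cong three-corners ⟩
    ∑³ (λ a b c → 3 * τ a b c)
      ≡⟨ sym (*-distribˡ-∑³ 3 τ) ⟩
    3 * #triangles ∎
    where
    open ≡-Reasoning
    three-corners : ∀ a b c → ∑[ v < n ] (τ a b c * corner v a b c) ≡ 3 * τ a b c
    three-corners a b c with isTriangleᵇ (a , b , c) in isTri
    ... | true = corner-sum (subst T (sym isTri) tt) (λ _ → 1)
    ... | false = ∑-zero {n} λ _ → refl

  degree-sum-by-codes : sum (deg Γ) ≡ ∑[ v < n ] (high v * high-neighbours v) + ∑[ v < n ] (high v * triangles-at v)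
                                      + (∑[ v < n ] (high v * triangles-at v) + side-pairs)
  degree-sum-by-codes = begin
    sum (deg Γ)
      ≡⟨ degree-sum ⟩
    ∑[ v < n ] (high v * (high-neighbours v + triangles-at v)) + ∑³ (λ a b c → τ a b c * (high-corners a b c + side-neighbours a b c))
      ≡⟨ cong₂ _+_ (trans (sum-cong-≗ λ v → *-distribˡ-+ (high v) (high-neighbours v) (triangles-at v))
                          (∑-distrib-+ (λ v → high v * high-neighbours v) (λ v → high v * triangles-at v)))
                   (trans (∑³-cong λ a b c → *-distribˡ-+ (τ a b c) (high-corners a b c) (side-neighbours a b c))
                          (∑³-distrib-+ {λ a b c → τ a b c * high-corners a b c} {λ a b c → τ a b c * side-neighbours a b c})) ⟩
    ∑[ v < n ] (high v * high-neighbours v) + ∑[ v < n ] (high v * triangles-at v)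
      + (∑³ (λ a b c → τ a b c * high-corners a b c) + side-pairs)
      ≡⟨ cong (λ s → Z + H + (s + side-pairs)) (weighted-corner-count high) ⟩
    ∑[ v < n ] (high v * high-neighbours v) + ∑[ v < n ] (high v * triangles-at v)
      + (∑[ v < n ] (high v * triangles-at v) + side-pairs) ∎
    where
    open ≡-Reasoning
    Z = ∑[ v < n ] (high v * high-neighbours v)
    H = ∑[ v < n ] (high v * triangles-at v)

  degree-sum-by-kind : sum (deg Γ) ≡ ∑[ v < n ] (high v * high-neighbours v) + ∑[ v < n ] (low v * high-neighbours v)
                                     + ∑[ v < n ] (low v * deg Γ v)
  degree-sum-by-kind = begin
    sum (deg Γ)
      ≡⟨ split-by-degree (deg Γ) ⟩
    ∑[ v < n ] (high v * deg Γ v) + ∑[ v < n ] (low v * deg Γ v)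
      ≡⟨ cong (_+ B) (sum-cong-≗ λ v → trans (cong (high v *_) (degree-split v))
                                               (*-distribˡ-+ (high v) (high-neighbours v) (low-neighbours v))) ⟩
    ∑[ v < n ] (high v * high-neighbours v + high v * low-neighbours v) + ∑[ v < n ] (low v * deg Γ v)
      ≡⟨ cong (_+ B) (trans (∑-distrib-+ (λ v → high v * high-neighbours v) (λ v → high v * low-neighbours v))
                            (cong (∑[ v < n ] (high v * high-neighbours v) +_) high-low-exchange)) ⟩
    ∑[ v < n ] (high v * high-neighbours v) + ∑[ v < n ] (low v * high-neighbours v) + ∑[ v < n ] (low v * deg Γ v) ∎
    where
    open ≡-Reasoning
    B = ∑[ v < n ] (low v * deg Γ v)

  weight : Fin n → ℕ
  weight u = high-neighbours u + deg Γ u + 2 * triangles-at u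

  -- Comparing the two degree sums, and using that there are as many low vertices as triangles.
  weight-sum : ∑[ u < n ] (low u * weight u) ≡ ∑[ u < n ] (low u * 6) + side-pairs
  weight-sum = begin
    ∑[ u < n ] (low u * weight u)            ≡⟨ weight-split ⟩
    A + B + 2 * Y                             ≡⟨ cong (λ s → s + 2 * Y) A+B≡2H+P ⟩
    H + H + side-pairs + 2 * Y                ≡⟨ regroup H Y side-pairs ⟩
    2 * (H + Y) + side-pairs                  ≡⟨ cong (λ s → 2 * s + side-pairs) H+Y≡3#triangles ⟩
    2 * (3 * #triangles) + side-pairs         ≡⟨ cong (λ s → 2 * (3 * s) + side-pairs) (sym #low≡#triangles) ⟩
    2 * (3 * sum low) + side-pairs            ≡⟨ cong (_+ side-pairs) (trans (six (sum low)) (*-distribʳ-sum 6 low)) ⟩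
    ∑[ u < n ] (low u * 6) + side-pairs       ∎
    where
    open ≡-Reasoning
    Z = ∑[ v < n ] (high v * high-neighbours v)
    A = ∑[ v < n ] (low v * high-neighbours v)
    B = ∑[ v < n ] (low v * deg Γ v)
    H = ∑[ v < n ] (high v * triangles-at v)
    Y = ∑[ v < n ] (low v * triangles-at v)
    regroup : ∀ h y p → h + h + p + 2 * y ≡ 2 * (h + y) + p
    regroup = solve-∀
    six : ∀ s → 2 * (3 * s) ≡ s * 6
    six = solve-∀
    distrib : ∀ l h d t → l * (h + d + 2 * t) ≡ l * h + l * d + 2 * (l * t)
    distrib = solve-∀
    shuffle : ∀ z h p → z + h + (h + p) ≡ z + (h + h + p)
    shuffle = solve-∀
    weight-split : ∑[ u < n ] (low u * weight u) ≡ A + B + 2 * Y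
    weight-split = trans (sum-cong-≗ λ u → distrib (low u) (high-neighbours u) (deg Γ u) (triangles-at u))
      (trans (∑-distrib-+ (λ u → low u * high-neighbours u + low u * deg Γ u) (λ u → 2 * (low u * triangles-at u)))
             (cong₂ _+_ (∑-distrib-+ (λ u → low u * high-neighbours u) (λ u → low u * deg Γ u))
                        (sym (*-distribˡ-sum 2 λ u → low u * triangles-at u))))
    A+B≡2H+P : A + B ≡ H + H + side-pairs
    A+B≡2H+P = +-cancelˡ-≡ Z _ _ (trans (sym (+-assoc Z A B))
      (trans (sym degree-sum-by-kind) (trans degree-sum-by-codes (shuffle Z H side-pairs))))
    H+Y≡3#triangles : H + Y ≡ 3 * #triangles
    H+Y≡3#triangles = trans (sym (split-by-degree triangles-at)) corner-count

  private
    𝟙*≤ : ∀ b m → 𝟙 b * m ≤ m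
    𝟙*≤ true m = ≤-reflexive (+-identityʳ m)
    𝟙*≤ false m = z≤n

    low≡1 : ∀ {u} → (deg Γ u ≡ᵇ 3) ≡ false → low u ≡ 1
    low≡1 d3 = cong (𝟙 ∘ not) d3

  low⇒deg≤2 : ∀ {u} → low u ≡ 1 → deg Γ u ≤ 2
  low⇒deg≤2 {u} low-u with deg Γ u ≡ᵇ 3 in d3 | m≤n⇒m<n∨m≡n (degree≤3 conn u)
  ... | true | _ with () ← low-u
  ... | false | inj₁ deg<3 = ≤-pred deg<3
  ... | false | inj₂ deg≡3 = ⊥-elim (subst T d3 (≡⇒≡ᵇ _ 3 deg≡3))

  high-neighbours≤deg : ∀ u → high-neighbours u ≤ deg Γ u
  high-neighbours≤deg u = subst (high-neighbours u ≤_) (sym (deg≡∑ u)) (∑-mono-≤ λ v → 𝟙*≤ (deg Γ v ≡ᵇ 3) (𝟙 (edge? Γ u v)))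

  -- A vertex of degree at most 2 lies on at most one triangle, so only one term of the sum survives.
  triangles-at≤1 : ∀ {u} → deg Γ u ≤ 2 → triangles-at u ≤ 1
  triangles-at≤1 {u} deg≤2 with triangles-at u in eq
  ... | zero = z≤n
  ... | suc k with ∑³-positive (λ a b c → τ a b c * corner u a b c) (subst (0 <_) (sym eq) (s≤s z≤n))
  ... | (a₀ , b₀ , c₀) , pos = subst (_≤ 1) eq
        (≤-trans (∑³-mono-≤ only-t₀) (≤-reflexive (∑³-δᶜ a₀ b₀ c₀ λ _ _ _ → 1)))
    where
    t₀-facts = 𝟙*𝟙-positive {isTriangleᵇ (a₀ , b₀ , c₀)} {u ∈ᵇ (a₀ , b₀ , c₀)} pos
    t₀ = tri a₀ b₀ c₀ (proj₁ t₀-facts)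
    u∈t₀ : u ∈ᵗ t₀
    u∈t₀ = Equivalence.to (∈ᵇ⇔ (a₀ , b₀ , c₀)) (proj₂ t₀-facts)
    only-t₀ : ∀ a b c → τ a b c * corner u a b c ≤ δᶜ (inj₂ (a₀ , b₀ , c₀)) (inj₂ (a , b , c)) 1
    only-t₀ a b c with isTriangleᵇ (a , b , c) in isTri | u ∈ᵇ (a , b , c) in u∈
    ... | false | _ = z≤n
    ... | true | false = z≤n
    ... | true | true = ≤-reflexive (sym (trans (cong (λ P → δᶜ (inj₂ (a₀ , b₀ , c₀)) (inj₂ P) 1) same) (δᶜ-diag (inj₂ (a₀ , b₀ , c₀)) 1)))
      where
      t = tri a b c (subst T (sym isTri) tt)
      same : (a , b , c) ≡ (a₀ , b₀ , c₀)
      same = cong TΓ.vertices (deg≤2-triangle-unique t t₀ deg≤2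
               (Equivalence.to (∈ᵇ⇔ (a , b , c)) (subst T (sym u∈) tt)) u∈t₀)

  weight≤6 : ∀ {u} → deg Γ u ≤ 2 → weight u ≤ 6
  weight≤6 {u} deg≤2 =
    +-mono-≤ (+-mono-≤ (≤-trans (high-neighbours≤deg u) deg≤2) deg≤2) (*-monoʳ-≤ 2 (triangles-at≤1 deg≤2))

  low-weight≤ : ∀ u → low u * weight u ≤ low u * 6
  low-weight≤ u with deg Γ u ≡ᵇ 3 in d3
  ... | true = z≤n
  ... | false = *-monoʳ-≤ 1 (weight≤6 (low⇒deg≤2 {u} (low≡1 {u} d3)))

  side-pairs≡0 : side-pairs ≡ 0
  side-pairs≡0 = n≤0⇒n≡0 (+-cancelˡ-≤ (∑[ u < n ] (low u * 6)) side-pairs 0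
    (≤-trans (≤-reflexive (sym weight-sum)) (≤-trans (∑-mono-≤ low-weight≤) (≤-reflexive (sym (+-identityʳ _))))))

  low-profile : ∀ {u} → low u ≡ 1 → high-neighbours u ≡ 2 × deg Γ u ≡ 2 × triangles-at u ≡ 1
  low-profile {u} low-u = hn≡2 , deg≡2 , *-cancelˡ-≡ _ _ 2 2ta≡2
    where
    deg≤2 = low⇒deg≤2 {u} low-u
    hn≤2 = ≤-trans (high-neighbours≤deg u) deg≤2
    weight≡6 : weight u ≡ 6
    weight≡6 = *-cancelˡ-≡ _ _ 1 (subst (λ l → l * weight u ≡ l * 6) low-u
      (∑-≤-pointwise-≡ low-weight≤ (trans weight-sum (trans (cong (∑[ v < n ] (low v * 6) +_) side-pairs≡0) (+-identityʳ _))) u))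
    split₁ = +-tight (+-mono-≤ hn≤2 deg≤2) (*-monoʳ-≤ 2 (triangles-at≤1 deg≤2)) weight≡6
    2ta≡2 = proj₂ split₁
    split₂ = +-tight hn≤2 deg≤2 (proj₁ split₁)
    hn≡2 = proj₁ split₂
    deg≡2 = proj₂ split₂

  condition₁ : Cond1 Γ
  condition₁ v with deg Γ v ≡ᵇ 3 in d3
  ... | true = inj₂ (≡ᵇ⇒≡ _ 3 (subst T (sym d3) tt))
  ... | false = inj₁ (proj₁ (proj₂ (low-profile {v} (low≡1 {v} d3))))

  deg2⇒low : ∀ {v} → deg Γ v ≡ 2 → low v ≡ 1
  deg2⇒low d2 = cong (λ d → 𝟙 (not (d ≡ᵇ 3))) d2

  on-some-triangle : ∀ {v} → 0 < triangles-at v → ∃ λ (t : Triangle (finO Γ)) → v ∈ᵗ t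
  on-some-triangle {v} pos =
    let ((a , b , c) , p) = ∑³-positive (λ a b c → τ a b c * corner v a b c) pos
        (isTri , v∈) = 𝟙*𝟙-positive {isTriangleᵇ (a , b , c)} {v ∈ᵇ (a , b , c)} p
    in tri a b c isTri , Equivalence.to (∈ᵇ⇔ (a , b , c)) v∈

  condition₂ : Cond2 Γ
  condition₂ v d2 = on-some-triangle (subst (0 <_) (sym (proj₂ (proj₂ (low-profile {v} (deg2⇒low d2))))) (s≤s z≤n))

  low-neighbour-high : ∀ {u w} → low u ≡ 1 → Adj u w → high w ≡ 1
  low-neighbour-high {u} {w} low-u uw = trans (sym (*-identityʳ (high w))) (subst (λ m → high w * m ≡ m) (T⇒𝟙≡1 {edge? Γ u w} uw)
    (∑-≤-pointwise-≡ (λ v → 𝟙*≤ (deg Γ v ≡ᵇ 3) (𝟙 (edge? Γ u v))) (trans hn≡2 (trans (sym deg≡2) (deg≡∑ u))) w))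
    where
    hn≡2 = proj₁ (low-profile {u} low-u)
    deg≡2 = proj₁ (proj₂ (low-profile {u} low-u))

  lows-not-adjacent : ∀ {x y} → Adj x y → ¬ (T (not (deg Γ x ≡ᵇ 3)) × T (not (deg Γ y ≡ᵇ 3)))
  lows-not-adjacent {x} {y} xy (low-x , low-y) = 1≢2 (begin
    1               ≡⟨ sym (high+low≡1 y) ⟩
    high y + low y  ≡⟨ cong₂ _+_ (low-neighbour-high {x} {y} (T⇒𝟙≡1 {not (deg Γ x ≡ᵇ 3)} low-x) xy)
                                 (T⇒𝟙≡1 {not (deg Γ y ≡ᵇ 3)} low-y) ⟩
    2               ∎)
    where
    open ≡-Reasoning
    1≢2 : 1 ≢ 2
    1≢2 ()

  one-low-corner : ∀ {a b c} → T (isTriangleᵇ (a , b , c)) → low a + low b + low c ≡ 1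
  one-low-corner {a} {b} {c} isTri = begin
    low a + low b + low c                          ≡⟨ sym (corner-sum isTri low) ⟩
    low-corners a b c                              ≡⟨ sym (*-identityˡ (low-corners a b c)) ⟩
    1 * low-corners a b c                          ≡⟨ cong (_* low-corners a b c) (sym (T⇒𝟙≡1 {isTriangleᵇ (a , b , c)} isTri)) ⟩
    τ a b c * low-corners a b c                    ≡⟨ ∑³-≤-pointwise-≡ bounded sums-agree a b c ⟩
    τ a b c                                        ≡⟨ T⇒𝟙≡1 {isTriangleᵇ (a , b , c)} isTri ⟩
    1                                              ∎
    where
    open ≡-Reasoning
    low-corners : Fin n → Fin n → Fin n → ℕ
    low-corners a b c = ∑[ v < n ] (low v * corner v a b c)
    bounded : ∀ a b c → τ a b c * low-corners a b c ≤ τ a b c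
    bounded a b c with isTriangleᵇ (a , b , c) in isTri′
    ... | false = z≤n
    ... | true = let t = tri a b c (subst T (sym isTri′) tt) in
      ≤-trans (≤-reflexive (trans (+-identityʳ _) (corner-sum (subst T (sym isTri′) tt) low)))
              (at-most-one (not (deg Γ a ≡ᵇ 3)) (not (deg Γ b ≡ᵇ 3)) (not (deg Γ c ≡ᵇ 3))
                           (lows-not-adjacent {a} {b} (TΓ.adj-ab t)) (lows-not-adjacent {a} {c} (TΓ.adj-ac t))
                           (lows-not-adjacent {b} {c} (TΓ.adj-bc t)))
    low·triangles-at : ∀ v → low v * triangles-at v ≡ low v
    low·triangles-at v with deg Γ v ≡ᵇ 3 in d3
    ... | true = refl
    ... | false = trans (+-identityʳ _) (proj₂ (proj₂ (low-profile {v} (low≡1 {v} d3))))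
    sums-agree : ∑³ (λ a b c → τ a b c * low-corners a b c) ≡ #triangles
    sums-agree = trans (weighted-corner-count low) (trans (sum-cong-≗ low·triangles-at) #low≡#triangles)

  condition₃ : Cond3 Γ
  condition₃ (tri a b c isTri) =
    trans (cong₂ _+_ (cong₂ _+_ (deg2≡low a) (deg2≡low b)) (deg2≡low c)) (one-low-corner (recompute (T? _) isTri))
    where
    deg2≡low : ∀ x → (if deg Γ x ≡ᵇ 2 then 1 else 0) ≡ low x
    deg2≡low x with condition₁ x
    ... | inj₁ d2 rewrite d2 = refl
    ... | inj₂ d3 rewrite d3 = refl

  no-shared-side : ∀ t t′ → t ≢ t′ → ¬ ShareSide t t′
  no-shared-side t@(tri a b c isTri) t′@(tri a′ b′ c′ isTri′) t≢t′ share = <-irrefl (sym side-pairs≡0) (begin-strict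
    0                                                                     <⟨ s≤s z≤n ⟩
    1                                                                     ≡⟨ sym one ⟩
    τ a b c * (τ a′ b′ c′ * 𝟙 (adjᶜ (inj₂ (a , b , c)) (inj₂ (a′ , b′ , c′))))
          ≤⟨ *-monoʳ-≤ (τ a b c) (term≤∑³ (λ a′ b′ c′ → τ a′ b′ c′ * 𝟙 (adjᶜ (inj₂ (a , b , c)) (inj₂ (a′ , b′ , c′)))) a′ b′ c′) ⟩
    τ a b c * side-neighbours a b c                                       ≤⟨ term≤∑³ (λ a b c → τ a b c * side-neighbours a b c) a b c ⟩
    side-pairs                                                            ∎)
    where
    open ≤-Reasoning
    one : τ a b c * (τ a′ b′ c′ * 𝟙 (adjᶜ (inj₂ (a , b , c)) (inj₂ (a′ , b′ , c′)))) ≡ 1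
    one rewrite T⇒𝟙≡1 {isTriangleᵇ (a , b , c)} (recompute (T? _) isTri)
              | T⇒𝟙≡1 {isTriangleᵇ (a′ , b′ , c′)} (recompute (T? _) isTri′)
              | T⇒𝟙≡1 {adjᶜ (inj₂ (a , b , c)) (inj₂ (a′ , b′ , c′))} (adjᶜ-sides {t} {t′} t≢t′ share) = refl

  -- Two triangles through v that share no side would give v four neighbours.
  condition₄ : Cond4 Γ
  condition₄ t t′ t≢t′ v v∈t v∈t′
    with TΓ.other-two t v∈t | TΓ.other-two t′ v∈t′
  ... | x , y , (_ , (_ , x∈t , y∈t)) , v≢x , v≢y , x≢y | x′ , y′ , (_ , (_ , x′∈t′ , y′∈t′)) , v≢x′ , v≢y′ , x′≢y′ =
    <-irrefl refl (≤-trans (unique-neighbours≤deg distinct adjacent) (degree≤3 conn v))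
    where
    off-t′ : ∀ {w} → w ∈ᵗ t → v ≢ w → ¬ w ∈ᵗ t′
    off-t′ w∈t v≢w w∈t′ = no-shared-side t t′ t≢t′ (_ , _ , v≢w , (v∈t , w∈t) , (v∈t′ , w∈t′))
    apart : ∀ {w w′} → ¬ w ∈ᵗ t′ → w′ ∈ᵗ t′ → w ≢ w′
    apart w∉t′ w′∈t′ refl = w∉t′ w′∈t′
    x∉t′ = off-t′ x∈t v≢x
    y∉t′ = off-t′ y∈t v≢y
    distinct = (x≢y ∷ apart x∉t′ x′∈t′ ∷ apart x∉t′ y′∈t′ ∷ []) ∷ (apart y∉t′ x′∈t′ ∷ apart y∉t′ y′∈t′ ∷ [])
             ∷ (x′≢y′ ∷ []) ∷ [] ∷ []
    adjacent = TΓ.∈ᵗ-adj t v∈t x∈t v≢x ∷ TΓ.∈ᵗ-adj t v∈t y∈t v≢y ∷ TΓ.∈ᵗ-adj t′ v∈t′ x′∈t′ v≢x′ ∷ TΓ.∈ᵗ-adj t′ v∈t′ y′∈t′ v≢y′ ∷ []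

theorem2p8 : ∀ {n} (Γ : FinGraph n) → Connected Γ →
    (C₃ (L Γ) ≅ finG Γ) ⇔ (Cond1 Γ × Cond2 Γ × Cond3 Γ × Cond4 Γ)
theorem2p8 Γ conn = mk⇔
  (λ iso → let open FromIsomorphism Γ conn iso in condition₁ , condition₂ , condition₃ , condition₄)
  (λ (deg∈23 , deg2-on-triangle , one-deg2 , disjoint) → FromConditions.isomorphism Γ deg∈23 deg2-on-triangle one-deg2 disjoint)
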